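{- There is an absolute constant $C$ such that the following holds. Let $R=(R[1],\dots,R[n])$ be a row with entries in $\{0,1,2,3\}$, and let $\rho$ be its number of markers. Then $R$ has a segmentation consisting of at most $\frac12\rho+C$ segments with value $1$, at most $\frac14\rho$ segments with value $2$, and at most $\frac16\rho$ segments with value $3$.
   Context: A segment of a $1\times n$ row is a $1\times n$ row with non-negative integer entries whose non-zero entries all equal the same positive integer (its value) and occupy consecutive positions. A segmentation of $R$ is a finite multiset of segments summing to $R$. Setting $R[0]=R[n+1]=0$, a marker of $R$ is an index $j\in\{1,\dots,n+1\}$ with $R[j-1]\ne R[j]$. -}

module Defs where

open import Data.Nat using (ℕ; zero; suc; _+_; _*_; _≤_; _<_; _≤ᵇ_; _<ᵇ_; _≡ᵇ_)
open import Data.Nat.Properties using (_≟_)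
open import Data.Bool using (Bool; true; false; if_then_else_; _∧_)
open import Data.Fin using (Fin; toℕ)
open import Data.List using (List; []; _∷_; length; filter)
open import Data.Vec.Functional using (Vector)
open import Relation.Nullary using (¬_; Dec; yes; no)
open import Relation.Binary.PropositionalEquality using (_≡_)

-- A 1×n row with natural-number entries, indexed by Fin n
-- (position i : Fin n corresponds to the paper's index toℕ i + 1).
Row : ℕ → Set
Row n = Vector ℕ n

-- A segment of a 1×n row: value v ≥ 1, occupying the consecutive
-- positions start, …, start + len - 1 (0-based), with len ≥ 1 and
-- start + len ≤ n.
record Segment (n : ℕ) : Set where
  constructor seg
  field
    value   : ℕ
    start   : ℕ
    len     : ℕ
    value>0 : 0 < value
    len>0   : 0 < len
    fits    : start + len ≤ n
open Segment public

segRow : ∀ {n} → Segment n → Row n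
segRow s i =
  if (start s ≤ᵇ toℕ i) ∧ (toℕ i <ᵇ start s + len s) then value s else 0

sumSegs : ∀ {n} → List (Segment n) → Row n
sumSegs []       i = 0
sumSegs (s ∷ ss) i = segRow s i + sumSegs ss i

IsSegmentation : ∀ {n} → Row n → List (Segment n) → Set
IsSegmentation R ss = ∀ i → sumSegs ss i ≡ R i

countValue : ∀ {n} → ℕ → List (Segment n) → ℕ
countValue k ss = length (filter (λ s → value s ≟ k) ss)

-- Entry R[j] for j ∈ {0, …, n+1} (paper indexing), with R[0] = R[n+1] = 0.
padded : ∀ {n} → Row n → ℕ → ℕ
padded {n} R zero = 0
padded {zero} R (suc j) = 0
padded {suc n} R (suc zero) = R Fin.zero
padded {suc n} R (suc (suc j)) = padded {n} (λ i → R (Fin.suc i)) (suc j)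

-- Number of markers: #{ j ∈ {1, …, n+1} | R[j-1] ≠ R[j] }.
markersFrom : ∀ {n} → Row n → ℕ → ℕ → ℕ
markersFrom R j zero = 0
markersFrom R j (suc k) =
  (if padded R j ≡ᵇ padded R (suc j) then 0 else 1) + markersFrom R (suc j) k

markers : ∀ {n} → Row n → ℕ
markers {n} R = markersFrom R 0 (suc n)

module Submission where

-- Read a row from left to right as its sequence of heights, h₀ = 0, h₁, …,
-- hₙ, 0.  The segments open at a position are organised in groups (the open
-- segments that started at the same position, recorded by their total); at
-- every change of height a *closing* ends some segments in each group and a
-- new group covers the rest of the new height.  Closings are
-- then chosen from a finite table of moves carrying three potentials, one
-- per value v, that bound 2v·#(segments of value v) − ρ with ρ the number of
-- height changes so far.  The type checker certifies, by evaluating a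
-- decision procedure, that the table always offers an affordable move and
-- ends with 2·#1 ≤ ρ + 6, 4·#2 ≤ ρ, 6·#3 ≤ ρ; hence the theorem with C = 3.

open import Defs
open import Data.Bool using (true; false; if_then_else_; _∧_)
open import Data.Empty using (⊥-elim)
open import Data.Fin as Fin using (toℕ)
open import Data.Maybe using (Maybe; just; nothing)
import Data.Maybe.Properties as Maybe
open import Data.Nat using (ℕ; zero; suc; _+_; _*_; _∸_; _≤_; _<_; _≤?_; _<?_; _≡ᵇ_; _≤ᵇ_; _<ᵇ_; z≤n; s≤s)
open import Data.Nat.Properties
  using (_≟_; ≤-trans; ≤-reflexive; ≤-antisym; +-assoc; +-comm; +-suc; +-identityʳ; +-monoˡ-≤; +-cancelˡ-≤;
         *-distribˡ-+; m≤m+n; m≤n+m; m∸n+n≡m; m+[n∸m]≡n; n∸n≡0; m∸n≡0⇒m≤n; n≤0⇒n≡0;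
         m+n≡0⇒m≡0; m+n≡0⇒n≡0;
         ≡⇒≡ᵇ; ≡ᵇ⇒≡; +-commutativeSemigroup; module ≤-Reasoning)
open import Algebra.Properties.CommutativeSemigroup +-commutativeSemigroup using (interchange)
open import Data.Nat.ListAction using (sum)
open import Data.Nat.ListAction.Properties using (sum-++)
open import Data.Product using (Σ-syntax; ∃-syntax; _×_; _,_; proj₁; proj₂)
open import Data.List using (List; []; _∷_; _++_; map; concat; filter; length; replicate; zipWith; upTo)
open import Data.List.Properties using (map-++; map-∘; map-id; map-cong; filter-++; length-++; ++-identityʳ; ≡-dec)
open import Data.List.Relation.Unary.All using (All; []; _∷_; all?; lookupAny)
import Data.List.Relation.Unary.All as All
open import Data.List.Relation.Unary.All.Properties using (map⁺; ++⁺)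
open import Data.List.Relation.Unary.Any using (Any; here; any?)
import Data.List.Relation.Unary.Any as Any
open import Data.List.Relation.Unary.Any.Properties using () renaming (singleton⁻ to Any-singleton⁻)
open import Data.List.Relation.Binary.Pointwise using (Pointwise; []; _∷_)
import Data.List.Relation.Binary.Pointwise as Pointwise
open import Data.List.Membership.Propositional using (_∈_)
open import Data.List.Membership.Propositional.Properties using (∈-map⁺; ∈-filter⁺; ∈-++⁺ˡ; ∈-++⁺ʳ; ∈-upTo⁺)
open import Function using (_∘_)
open import Relation.Nullary using (Dec; yes; no; ¬?)
open import Relation.Nullary.Decidable using (_×-dec_; toWitness)
open import Relation.Binary.PropositionalEquality
  using (_≡_; _≢_; refl; sym; trans; cong; cong₂; subst; subst₂; module ≡-Reasoning)

-- The open groups, the most recently opened first.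
Groups : Set
Groups = List ℕ

-- A closing lists, for every group, the values of its segments ending here.
Closing : Set
Closing = List (List ℕ)

ClosesGroup : ℕ → List ℕ → Set
ClosesGroup a r = sum r ≤ a × All (0 <_) r

Fits : Groups → Closing → Set
Fits = Pointwise ClosesGroup

remainders : Groups → Closing → Groups
remainders = zipWith (λ a r → a ∸ sum r)

ValidClosing : Groups → Closing → ℕ → Set
ValidClosing gl rp x = Fits gl rp × sum (remainders gl rp) ≤ x

validClosing? : ∀ gl rp x → Dec (ValidClosing gl rp x)
validClosing? gl rp x =
  Pointwise.decidable (λ a r → (sum r ≤? a) ×-dec all? (0 <?_) r) gl rp
    ×-dec (sum (remainders gl rp) ≤? x)

reopen : Groups → Closing → ℕ → Groups
reopen gl rp x = (x ∸ sum (remainders gl rp)) ∷ remainders gl rp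

reopen-sum : ∀ {gl rp x} → ValidClosing gl rp x → sum (reopen gl rp x) ≡ x
reopen-sum (_ , rest≤x) = m∸n+n≡m rest≤x

-- Closing everything, as segments of value 1, is always valid; it is the
-- fallback when a table offers no move.
closeAll : Groups → Closing
closeAll = map (λ a → replicate a 1)

closeAll-valid : ∀ gl x → ValidClosing gl (closeAll gl) x
closeAll-valid gl x = closes gl , ≤-trans (≤-reflexive (nothing-open gl)) z≤n
  where
  ones-sum : ∀ a → sum (replicate a 1) ≡ a
  ones-sum zero    = refl
  ones-sum (suc a) = cong suc (ones-sum a)

  ones-positive : ∀ a → All (0 <_) (replicate a 1)
  ones-positive zero    = []
  ones-positive (suc a) = s≤s z≤n ∷ ones-positive a

  closes : ∀ gl → Fits gl (closeAll gl)
  closes []       = []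
  closes (a ∷ gl) = (≤-reflexive (ones-sum a) , ones-positive a) ∷ closes gl

  nothing-open : ∀ gl → sum (remainders gl (closeAll gl)) ≡ 0
  nothing-open []       = refl
  nothing-open (a ∷ gl) = cong₂ _+_ (trans (cong (a ∸_) (ones-sum a)) (n∸n≡0 a)) (nothing-open gl)

record Tally : Set where
  constructor tally
  field
    closed  : List ℕ
    changes : ℕ
open Tally

noTally : Tally
noTally = tally [] 0

recordClosing : Tally → Closing → Tally
recordClosing c rp = tally (closed c ++ concat rp) (suc (changes c))

occ : ℕ → List ℕ → ℕ
occ k vs = length (filter (_≟ k) vs)

occ-++ : ∀ k us vs → occ k (us ++ vs) ≡ occ k us + occ k vs
occ-++ k us vs = trans (cong length (filter-++ (_≟ k) us vs)) (length-++ (filter (_≟ k) us))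

-- The first height after the current height h that differs from it, together
-- with the rest of the row; `just 0` stands for the zero after the row and
-- `nothing` for the end, which only follows height 0.
ahead : ℕ → List ℕ → Maybe ℕ × List ℕ
ahead h [] with h ≟ 0
... | yes _ = nothing , []
... | no  _ = just 0 , []
ahead h (x ∷ xs) with h ≟ x
... | yes _ = ahead h xs
... | no  _ = just x , xs

following : Maybe ℕ × List ℕ → Maybe ℕ
following (nothing , _) = nothing
following (just x  , r) = proj₁ (ahead x r)

-- A finished segment of a suffix of the row: value, first position, width.
record Span : Set where
  constructor span
  field
    val from width : ℕ
open Span

spanAt : Span → ℕ → ℕ
spanAt s p = if (from s ≤ᵇ p) ∧ (p <ᵇ from s + width s) then val s else 0

coverage : List Span → ℕ → ℕ
coverage S p = sum (map (λ s → spanAt s p) S)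

shift : Span → Span
shift s = span (val s) (suc (from s)) (width s)

-- A segment of a group that is open at the start of a suffix: its value and
-- the number of leading positions of the suffix it covers.
Piece : Set
Piece = ℕ × ℕ

pieceAt : Piece → ℕ → ℕ
pieceAt q p = if p <ᵇ proj₂ q then proj₁ q else 0

groupCover : List Piece → ℕ → ℕ
groupCover ps p = sum (map (λ q → pieceAt q p) ps)

pieceCover : List (List Piece) → ℕ → ℕ
pieceCover P p = sum (map (λ ps → groupCover ps p) P)

valuesOf : List Piece → List ℕ
valuesOf = map proj₁

-- A piece closed just before the suffix, one growing by a position, and one
-- whose group opens at the first position of the suffix.
fresh : ℕ → Piece
fresh v = v , 0

extend : Piece → Piece
extend q = proj₁ q , suc (proj₂ q)

opened : Piece → Span
opened q = span (proj₁ q) 0 (suc (proj₂ q))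

combine : Closing → List (List Piece) → List (List Piece)
combine = zipWith (λ r ps → map fresh r ++ map extend ps)

Aligned : Groups → List (List Piece) → Set
Aligned = Pointwise (λ a ps → sum (valuesOf ps) ≡ a)

-- The sweep of a suffix of the row produces finished segments and, for every
-- group open before the suffix, its pieces.
record Result : Set where
  constructor result
  field
    spans  : List Span
    pieces : List (List Piece)
    final  : Tally
open Result

newest : List (List Piece) → List Piece
newest []      = []
newest (N ∷ _) = N

older : List (List Piece) → List (List Piece)
older []      = []
older (_ ∷ P) = P

stay : Result → Result
stay o = result (map shift (spans o)) (map (map extend) (pieces o)) (final o)

-- Prepending a position where the height changes with closing rp: the
-- newest group (opened here) becomes finished segments, the other groups
-- receive the closed values.
change : Closing → Result → Result
change rp o =
  result (map shift (spans o) ++ map opened (newest (pieces o))) (combine rp (older (pieces o))) (final o)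

cleared : Groups → Tally → Result
cleared gl c = result [] (map (λ _ → []) gl) c

closedAll : Closing → Tally → Result
closedAll rp c = result [] (map (map fresh) rp) (recordClosing c rp)

-- Alignment: the pieces of every group add up to its total.

valuesOf-fresh : ∀ r → valuesOf (map fresh r) ≡ r
valuesOf-fresh r = trans (sym (map-∘ r)) (map-id r)

valuesOf-extend : ∀ ps → valuesOf (map extend ps) ≡ valuesOf ps
valuesOf-extend ps = sym (map-∘ ps)

valuesOf-joined : ∀ r ps → valuesOf (map fresh r ++ map extend ps) ≡ r ++ valuesOf ps
valuesOf-joined r ps =
  trans (map-++ proj₁ (map fresh r) (map extend ps)) (cong₂ _++_ (valuesOf-fresh r) (valuesOf-extend ps))

aligned-nothing : ∀ {P} → Aligned [] P → P ≡ []
aligned-nothing [] = refl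

combine-aligned : ∀ {gl rp Q} → Fits gl rp → Aligned (remainders gl rp) Q → Aligned gl (combine rp Q)
combine-aligned [] [] = []
combine-aligned {a ∷ _} {r ∷ _} {ps ∷ _} ((r≤a , _) ∷ fits) (ps≡ ∷ al) = group ∷ combine-aligned fits al
  where
  open ≡-Reasoning
  group : sum (valuesOf (map fresh r ++ map extend ps)) ≡ a
  group = begin
    sum (valuesOf (map fresh r ++ map extend ps)) ≡⟨ cong sum (valuesOf-joined r ps) ⟩
    sum (r ++ valuesOf ps)                        ≡⟨ sum-++ r (valuesOf ps) ⟩
    sum r + sum (valuesOf ps)                     ≡⟨ cong (sum r +_) ps≡ ⟩
    sum r + (a ∸ sum r)                           ≡⟨ m+[n∸m]≡n r≤a ⟩
    a                                             ∎

stay-aligned : ∀ {gl} o → Aligned gl (pieces o) → Aligned gl (pieces (stay o))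
stay-aligned _ al = extended al
  where
  extended : ∀ {gl P} → Aligned gl P → Aligned gl (map (map extend) P)
  extended [] = []
  extended {P = ps ∷ _} (ps≡ ∷ al) = trans (cong sum (valuesOf-extend ps)) ps≡ ∷ extended al

change-aligned : ∀ {gl rp x} o → Fits gl rp → Aligned (reopen gl rp x) (pieces o) → Aligned gl (pieces (change rp o))
change-aligned (result _ (_ ∷ _) _) fits (_ ∷ al) = combine-aligned fits al

cleared-aligned : ∀ gl c → sum gl ≡ 0 → Aligned gl (pieces (cleared gl c))
cleared-aligned []       c _   = []
cleared-aligned (a ∷ gl) c gl0 = sym (m+n≡0⇒m≡0 a gl0) ∷ cleared-aligned gl c (m+n≡0⇒n≡0 a gl0)

closedAll-aligned : ∀ {gl rp} c → ValidClosing gl rp 0 → Aligned gl (pieces (closedAll rp c))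
closedAll-aligned c ([] , _) = []
closedAll-aligned {a ∷ _} {r ∷ _} c ((r≤a , _) ∷ fits , rest≤0) =
  trans (cong sum (valuesOf-fresh r)) (≤-antisym r≤a (m∸n≡0⇒m≤n (n≤0⇒n≡0 (≤-trans (m≤m+n _ _) rest≤0))))
  ∷ closedAll-aligned c (fits , ≤-trans (m≤n+m _ (a ∸ sum r)) rest≤0)

-- Coverage: finished segments and pieces together reproduce the heights.

covered : Result → ℕ → ℕ
covered o p = coverage (spans o) p + pieceCover (pieces o) p

coverage-++ : ∀ S S′ p → coverage (S ++ S′) p ≡ coverage S p + coverage S′ p
coverage-++ S S′ p = trans (cong sum (map-++ _ S S′)) (sum-++ (map (λ s → spanAt s p) S) _)

coverage-shift-zero : ∀ S → coverage (map shift S) 0 ≡ 0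
coverage-shift-zero []      = refl
coverage-shift-zero (_ ∷ S) = coverage-shift-zero S

coverage-shift-suc : ∀ S q → coverage (map shift S) (suc q) ≡ coverage S q
coverage-shift-suc [] q = refl
coverage-shift-suc (span v zero    w ∷ S) q = cong (_ +_) (coverage-shift-suc S q)
coverage-shift-suc (span v (suc f) w ∷ S) q = cong (_ +_) (coverage-shift-suc S q)

coverage-opened-zero : ∀ N → coverage (map opened N) 0 ≡ sum (valuesOf N)
coverage-opened-zero []      = refl
coverage-opened-zero (_ ∷ N) = cong (_ +_) (coverage-opened-zero N)

coverage-opened-suc : ∀ N q → coverage (map opened N) (suc q) ≡ groupCover N q
coverage-opened-suc []      q = refl
coverage-opened-suc (_ ∷ N) q = cong (_ +_) (coverage-opened-suc N q)

groupCover-extend-zero : ∀ ps → groupCover (map extend ps) 0 ≡ sum (valuesOf ps)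
groupCover-extend-zero []       = refl
groupCover-extend-zero (_ ∷ ps) = cong (_ +_) (groupCover-extend-zero ps)

groupCover-extend-suc : ∀ ps q → groupCover (map extend ps) (suc q) ≡ groupCover ps q
groupCover-extend-suc []       q = refl
groupCover-extend-suc (_ ∷ ps) q = cong (_ +_) (groupCover-extend-suc ps q)

groupCover-fresh : ∀ r p → groupCover (map fresh r) p ≡ 0
groupCover-fresh []      p = refl
groupCover-fresh (_ ∷ r) p = groupCover-fresh r p

groupCover-joined : ∀ r ps p → groupCover (map fresh r ++ map extend ps) p ≡ groupCover (map extend ps) p
groupCover-joined r ps p =
  trans (cong sum (map-++ _ (map fresh r) (map extend ps)))
        (trans (sum-++ (map (λ q → pieceAt q p) (map fresh r)) _)
               (cong (_+ groupCover (map extend ps) p) (groupCover-fresh r p)))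

combine-cover-zero : ∀ {gl rp Q} → Fits gl rp → Aligned (remainders gl rp) Q →
                     pieceCover (combine rp Q) 0 ≡ sum (remainders gl rp)
combine-cover-zero [] [] = refl
combine-cover-zero {rp = r ∷ _} {ps ∷ _} (_ ∷ fits) (ps≡ ∷ al) =
  cong₂ _+_ (trans (groupCover-joined r ps 0) (trans (groupCover-extend-zero ps) ps≡))
            (combine-cover-zero fits al)

combine-cover-suc : ∀ {gl rp Q} → Fits gl rp → Aligned (remainders gl rp) Q →
                    ∀ q → pieceCover (combine rp Q) (suc q) ≡ pieceCover Q q
combine-cover-suc [] [] q = refl
combine-cover-suc {rp = r ∷ _} {ps ∷ _} (_ ∷ fits) (_ ∷ al) q =
  cong₂ _+_ (trans (groupCover-joined r ps (suc q)) (groupCover-extend-suc ps q))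
            (combine-cover-suc fits al q)

stay-cover-zero : ∀ {gl} o → Aligned gl (pieces o) → covered (stay o) 0 ≡ sum gl
stay-cover-zero o al = cong₂ _+_ (coverage-shift-zero (spans o)) (extended al)
  where
  extended : ∀ {gl P} → Aligned gl P → pieceCover (map (map extend) P) 0 ≡ sum gl
  extended [] = refl
  extended {P = ps ∷ _} (ps≡ ∷ al) = cong₂ _+_ (trans (groupCover-extend-zero ps) ps≡) (extended al)

stay-cover-suc : ∀ o q → covered (stay o) (suc q) ≡ covered o q
stay-cover-suc o q = cong₂ _+_ (coverage-shift-suc (spans o) q) (extended (pieces o))
  where
  extended : ∀ P → pieceCover (map (map extend) P) (suc q) ≡ pieceCover P q
  extended []       = refl
  extended (ps ∷ P) = cong₂ _+_ (groupCover-extend-suc ps q) (extended P)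

change-cover-zero : ∀ {gl rp x} o → ValidClosing gl rp x → Aligned (reopen gl rp x) (pieces o) →
                    covered (change rp o) 0 ≡ x
change-cover-zero {gl} {rp} {x} (result S (N ∷ P) _) valid@(fits , _) (N≡ ∷ al) = begin
  coverage (map shift S ++ map opened N) 0 + pieceCover (combine rp P) 0
    ≡⟨ cong₂ _+_ (coverage-++ (map shift S) (map opened N) 0) (combine-cover-zero fits al) ⟩
  (coverage (map shift S) 0 + coverage (map opened N) 0) + sum (remainders gl rp)
    ≡⟨ cong (_+ sum (remainders gl rp))
            (cong₂ _+_ (coverage-shift-zero S) (trans (coverage-opened-zero N) N≡)) ⟩
  (x ∸ sum (remainders gl rp)) + sum (remainders gl rp)
    ≡⟨ reopen-sum valid ⟩
  x ∎
  where open ≡-Reasoning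

change-cover-suc : ∀ {gl rp x} o → Fits gl rp → Aligned (reopen gl rp x) (pieces o) →
                   ∀ q → covered (change rp o) (suc q) ≡ covered o q
change-cover-suc {rp = rp} (result S (N ∷ P) _) fits (_ ∷ al) q = begin
  coverage (map shift S ++ map opened N) (suc q) + pieceCover (combine rp P) (suc q)
    ≡⟨ cong₂ _+_ (coverage-++ (map shift S) (map opened N) (suc q)) (combine-cover-suc fits al q) ⟩
  (coverage (map shift S) (suc q) + coverage (map opened N) (suc q)) + pieceCover P q
    ≡⟨ cong (_+ pieceCover P q) (cong₂ _+_ (coverage-shift-suc S q) (coverage-opened-suc N q)) ⟩
  (coverage S q + groupCover N q) + pieceCover P q
    ≡⟨ +-assoc (coverage S q) (groupCover N q) (pieceCover P q) ⟩
  coverage S q + (groupCover N q + pieceCover P q) ∎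
  where open ≡-Reasoning

cleared-cover : ∀ gl c p → covered (cleared gl c) p ≡ 0
cleared-cover []       c p = refl
cleared-cover (_ ∷ gl) c p = cleared-cover gl c p

closedAll-cover : ∀ rp c p → covered (closedAll rp c) p ≡ 0
closedAll-cover []       c p = refl
closedAll-cover (r ∷ rp) c p = cong₂ _+_ (groupCover-fresh r p) (closedAll-cover rp c p)

-- Bounds: every finished segment is a genuine segment of the row.

SpanFits : ℕ → Span → Set
SpanFits n s = 0 < val s × 0 < width s × from s + width s ≤ n

PieceFits : ℕ → Piece → Set
PieceFits n q = 0 < proj₁ q × proj₂ q ≤ n

ResultFits : ℕ → Result → Set
ResultFits n o = All (SpanFits n) (spans o) × All (All (PieceFits n)) (pieces o)

shift-fits : ∀ {n s} → SpanFits n s → SpanFits (suc n) (shift s)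
shift-fits (v>0 , w>0 , fit) = v>0 , w>0 , s≤s fit

extend-fits : ∀ {n ps} → All (PieceFits n) ps → All (PieceFits (suc n)) (map extend ps)
extend-fits ps = map⁺ (All.map (λ (v>0 , w≤n) → v>0 , s≤s w≤n) ps)

fresh-fits : ∀ {n r} → All (0 <_) r → All (PieceFits n) (map fresh r)
fresh-fits r>0 = map⁺ (All.map (λ v>0 → v>0 , z≤n) r>0)

stay-fits : ∀ {n} o → ResultFits n o → ResultFits (suc n) (stay o)
stay-fits o (sf , pf) = map⁺ (All.map shift-fits sf) , map⁺ (All.map extend-fits pf)

change-fits : ∀ {gl rp n} o → Fits gl rp → ResultFits n o → ResultFits (suc n) (change rp o)
change-fits o fits (sf , pf) = ++⁺ (map⁺ (All.map shift-fits sf)) (opened-fits (newest-fits pf)) , combined fits (older-fits pf)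
  where
  newest-fits : ∀ {n P} → All (All (PieceFits n)) P → All (PieceFits n) (newest P)
  newest-fits []       = []
  newest-fits (f ∷ _) = f

  older-fits : ∀ {n P} → All (All (PieceFits n)) P → All (All (PieceFits n)) (older P)
  older-fits []       = []
  older-fits (_ ∷ fs) = fs

  opened-fits : ∀ {n N} → All (PieceFits n) N → All (SpanFits (suc n)) (map opened N)
  opened-fits ps = map⁺ (All.map (λ (v>0 , w≤n) → v>0 , s≤s z≤n , s≤s w≤n) ps)

  combined : ∀ {n gl rp Q} → Fits gl rp → All (All (PieceFits n)) Q → All (All (PieceFits (suc n))) (combine rp Q)
  combined [] _ = []
  combined (_ ∷ _) [] = []
  combined ((_ , r>0) ∷ fits) (f ∷ fs) = ++⁺ (fresh-fits r>0) (extend-fits f) ∷ combined fits fs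

cleared-fits : ∀ gl c → ResultFits 0 (cleared gl c)
cleared-fits gl c = [] , map⁺ (All.universal (λ _ → []) gl)

closedAll-fits : ∀ {gl rp} c → Fits gl rp → ResultFits 0 (closedAll rp c)
closedAll-fits c fits = [] , map⁺ (closes fits)
  where
  closes : ∀ {gl rp} → Fits gl rp → All (λ r → All (PieceFits 0) (map fresh r)) rp
  closes []                  = []
  closes ((_ , r>0) ∷ fits) = fresh-fits r>0 ∷ closes fits

-- Counting: the values produced are exactly the values closed.

values : Result → List ℕ
values o = map val (spans o) ++ concat (map valuesOf (pieces o))

stay-values : ∀ o → values (stay o) ≡ values o
stay-values o =
  cong₂ _++_ (sym (map-∘ (spans o)))
             (cong concat (trans (sym (map-∘ (pieces o))) (map-cong valuesOf-extend (pieces o))))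

combine-values : ∀ k {gl rp Q} → Fits gl rp → Aligned (remainders gl rp) Q →
                 occ k (concat (map valuesOf (combine rp Q))) ≡ occ k (concat rp) + occ k (concat (map valuesOf Q))
combine-values k [] [] = refl
combine-values k {rp = r ∷ rp} {ps ∷ Q} (_ ∷ fits) (_ ∷ al) = begin
  occ k (valuesOf (map fresh r ++ map extend ps) ++ concat (map valuesOf (combine rp Q)))
    ≡⟨ occ-++ k (valuesOf (map fresh r ++ map extend ps)) _ ⟩
  occ k (valuesOf (map fresh r ++ map extend ps)) + occ k (concat (map valuesOf (combine rp Q)))
    ≡⟨ cong₂ _+_ (trans (cong (occ k) (valuesOf-joined r ps)) (occ-++ k r (valuesOf ps)))
                 (combine-values k fits al) ⟩
  (occ k r + occ k (valuesOf ps)) + (occ k (concat rp) + occ k (concat (map valuesOf Q)))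
    ≡⟨ interchange (occ k r) (occ k (valuesOf ps)) (occ k (concat rp)) _ ⟩
  (occ k r + occ k (concat rp)) + (occ k (valuesOf ps) + occ k (concat (map valuesOf Q)))
    ≡⟨ sym (cong₂ _+_ (occ-++ k r (concat rp)) (occ-++ k (valuesOf ps) _)) ⟩
  occ k (r ++ concat rp) + occ k (valuesOf ps ++ concat (map valuesOf Q)) ∎
  where open ≡-Reasoning

change-values : ∀ k {gl rp x} o → Fits gl rp → Aligned (reopen gl rp x) (pieces o) →
                occ k (values (change rp o)) ≡ occ k (values o) + occ k (concat rp)
change-values k {rp = rp} (result S (N ∷ P) _) fits (_ ∷ al) = begin
  occ k (map val (map shift S ++ map opened N) ++ concat (map valuesOf (combine rp P)))
    ≡⟨ occ-++ k (map val (map shift S ++ map opened N)) _ ⟩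
  occ k (map val (map shift S ++ map opened N)) + occ k (concat (map valuesOf (combine rp P)))
    ≡⟨ cong₂ _+_ (trans (cong (occ k) finished) (occ-++ k (map val S) (valuesOf N))) (combine-values k fits al) ⟩
  (A + B) + (D + C)              ≡⟨ cong ((A + B) +_) (+-comm D C) ⟩
  (A + B) + (C + D)              ≡⟨ sym (+-assoc (A + B) C D) ⟩
  ((A + B) + C) + D              ≡⟨ cong (_+ D) (+-assoc A B C) ⟩
  (A + (B + C)) + D              ≡⟨ cong (_+ D) (sym (trans (occ-++ k (map val S) _) (cong (A +_) (occ-++ k (valuesOf N) _)))) ⟩
  occ k (map val S ++ (valuesOf N ++ concat (map valuesOf P))) + D ∎
  where
  open ≡-Reasoning
  A B C D : ℕ
  A = occ k (map val S)
  B = occ k (valuesOf N)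
  C = occ k (concat (map valuesOf P))
  D = occ k (concat rp)
  finished : map val (map shift S ++ map opened N) ≡ map val S ++ valuesOf N
  finished = trans (map-++ val (map shift S) (map opened N)) (cong₂ _++_ (sym (map-∘ S)) (sym (map-∘ N)))

cleared-values : ∀ gl c → values (cleared gl c) ≡ []
cleared-values []       c = refl
cleared-values (_ ∷ gl) c = cleared-values gl c

closedAll-values : ∀ rp c → values (closedAll rp c) ≡ concat rp
closedAll-values []       c = refl
closedAll-values (r ∷ rp) c = cong₂ _++_ (valuesOf-fresh r) (closedAll-values rp c)

differ : ℕ → ℕ → ℕ
differ a b = if a ≡ᵇ b then 0 else 1

differ-≡ : ∀ {a b} → a ≡ b → differ a b ≡ 0
differ-≡ {a} refl with a ≡ᵇ a | ≡⇒≡ᵇ a a refl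
... | true  | _  = refl
... | false | ()

differ-≢ : ∀ {a b} → a ≢ b → differ a b ≡ 1
differ-≢ {a} {b} a≢b with a ≡ᵇ b | ≡ᵇ⇒≡ a b
... | true  | eq = ⊥-elim (a≢b (eq _))
... | false | _  = refl

changeCount : ℕ → List ℕ → ℕ
changeCount h []       = differ h 0
changeCount h (x ∷ xs) = differ h x + changeCount x xs

rowList : ∀ {n} → Row n → List ℕ
rowList {zero}  R = []
rowList {suc n} R = R Fin.zero ∷ rowList (R ∘ Fin.suc)

heightAt : List ℕ → ℕ → ℕ
heightAt []       p       = 0
heightAt (x ∷ xs) zero    = x
heightAt (x ∷ xs) (suc p) = heightAt xs p

heightAt-rowList : ∀ {n} (R : Row n) i → heightAt (rowList R) (toℕ i) ≡ R i
heightAt-rowList {suc n} R Fin.zero    = refl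
heightAt-rowList {suc n} R (Fin.suc i) = heightAt-rowList (R ∘ Fin.suc) i

length-rowList : ∀ {n} (R : Row n) → length (rowList R) ≡ n
length-rowList {zero}  R = refl
length-rowList {suc n} R = cong suc (length-rowList (R ∘ Fin.suc))

rowList-bounded : ∀ {n} (R : Row n) → (∀ i → R i ≤ 3) → All (_≤ 3) (rowList R)
rowList-bounded {zero}  R R≤3 = []
rowList-bounded {suc n} R R≤3 = R≤3 Fin.zero ∷ rowList-bounded (R ∘ Fin.suc) (R≤3 ∘ Fin.suc)

changesAlong : (ℕ → ℕ) → ℕ → ℕ → ℕ
changesAlong f j zero    = 0
changesAlong f j (suc k) = differ (f j) (f (suc j)) + changesAlong f (suc j) k

changesAlong-shift : ∀ f j k → changesAlong f (suc j) k ≡ changesAlong (f ∘ suc) j k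
changesAlong-shift f j zero    = refl
changesAlong-shift f j (suc k) = cong (_ +_) (changesAlong-shift f (suc j) k)

changesAlong-cong : ∀ {f g} → (∀ t → f t ≡ g t) → ∀ j k → changesAlong f j k ≡ changesAlong g j k
changesAlong-cong f≗g j zero    = refl
changesAlong-cong f≗g j (suc k) =
  cong₂ _+_ (cong₂ differ (f≗g j) (f≗g (suc j))) (changesAlong-cong f≗g (suc j) k)

padFrom : ℕ → List ℕ → ℕ → ℕ
padFrom h xs zero    = h
padFrom h xs (suc j) = heightAt xs j

changesAlong-padFrom : ∀ h xs → changesAlong (padFrom h xs) 0 (suc (length xs)) ≡ changeCount h xs
changesAlong-padFrom h []       = +-identityʳ (differ h 0)
changesAlong-padFrom h (x ∷ xs) = cong (differ h x +_) (begin
  changesAlong (padFrom h (x ∷ xs)) 1 (suc (length xs))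
    ≡⟨ changesAlong-shift (padFrom h (x ∷ xs)) 0 (suc (length xs)) ⟩
  changesAlong (padFrom h (x ∷ xs) ∘ suc) 0 (suc (length xs))
    ≡⟨ changesAlong-cong tail-pad 0 (suc (length xs)) ⟩
  changesAlong (padFrom x xs) 0 (suc (length xs))
    ≡⟨ changesAlong-padFrom x xs ⟩
  changeCount x xs ∎)
  where
  open ≡-Reasoning
  tail-pad : ∀ t → padFrom h (x ∷ xs) (suc t) ≡ padFrom x xs t
  tail-pad zero    = refl
  tail-pad (suc t) = refl

padded-padFrom : ∀ {n} (R : Row n) j → padded R j ≡ padFrom 0 (rowList R) j
padded-padFrom         R zero          = refl
padded-padFrom {zero}  R (suc j)       = refl
padded-padFrom {suc n} R (suc zero)    = refl
padded-padFrom {suc n} R (suc (suc j)) = padded-padFrom (R ∘ Fin.suc) (suc j)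

markersFrom-changesAlong : ∀ {n} (R : Row n) j k → markersFrom R j k ≡ changesAlong (padded R) j k
markersFrom-changesAlong R j zero    = refl
markersFrom-changesAlong R j (suc k) = cong (_ +_) (markersFrom-changesAlong R (suc j) k)

markers-changeCount : ∀ {n} (R : Row n) → markers R ≡ changeCount 0 (rowList R)
markers-changeCount {n} R = begin
  markersFrom R 0 (suc n)
    ≡⟨ markersFrom-changesAlong R 0 (suc n) ⟩
  changesAlong (padded R) 0 (suc n)
    ≡⟨ changesAlong-cong (padded-padFrom R) 0 (suc n) ⟩
  changesAlong (padFrom 0 (rowList R)) 0 (suc n)
    ≡⟨ cong (changesAlong (padFrom 0 (rowList R)) 0 ∘ suc) (sym (length-rowList R)) ⟩
  changesAlong (padFrom 0 (rowList R)) 0 (suc (length (rowList R)))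
    ≡⟨ changesAlong-padFrom 0 (rowList R) ⟩
  changeCount 0 (rowList R) ∎
  where open ≡-Reasoning

toSegments : ∀ {n} (S : List Span) → All (SpanFits n) S → List (Segment n)
toSegments []      []                              = []
toSegments (s ∷ S) ((v>0 , w>0 , fit) ∷ S-fits) = seg (val s) (from s) (width s) v>0 w>0 fit ∷ toSegments S S-fits

toSegments-sum : ∀ {n} S (S-fits : All (SpanFits n) S) i → sumSegs (toSegments S S-fits) i ≡ coverage S (toℕ i)
toSegments-sum []      []                i = refl
toSegments-sum (s ∷ S) (_ ∷ S-fits) i = cong (spanAt s (toℕ i) +_) (toSegments-sum S S-fits i)

toSegments-count : ∀ {n} k S (S-fits : All (SpanFits n) S) → countValue k (toSegments S S-fits) ≡ occ k (map val S)
toSegments-count k []      []           = refl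
toSegments-count k (s ∷ S) (_ ∷ S-fits) with val s ≡ᵇ k
... | true  = cong suc (toSegments-count k S S-fits)
... | false = toSegments-count k S S-fits

module Sweep (policy : Groups → ℕ → Maybe ℕ → Tally → Closing)
             (policy-valid : ∀ gl x y c → ValidClosing gl (policy gl x y c) x) where

  sweep : List ℕ → Groups → Tally → Result
  sweep [] gl c with sum gl ≟ 0
  ... | yes _ = cleared gl c
  ... | no  _ = closedAll (policy gl 0 nothing c) c
  sweep (x ∷ xs) gl c with sum gl ≟ x
  ... | yes _ = stay (sweep xs gl c)
  ... | no  _ = let rp = policy gl x (proj₁ (ahead x xs)) c in
                change rp (sweep xs (reopen gl rp x) (recordClosing c rp))

  sweep-aligned : ∀ xs gl c → Aligned gl (pieces (sweep xs gl c))
  sweep-aligned [] gl c with sum gl ≟ 0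
  ... | yes gl≡0 = cleared-aligned gl c gl≡0
  ... | no  _    = closedAll-aligned c (policy-valid gl 0 nothing c)
  sweep-aligned (x ∷ xs) gl c with sum gl ≟ x
  ... | yes _ = stay-aligned (sweep xs gl c) (sweep-aligned xs gl c)
  ... | no  _ = change-aligned (sweep xs _ _) (proj₁ (policy-valid gl x _ c)) (sweep-aligned xs _ _)

  sweep-covers : ∀ xs gl c p → covered (sweep xs gl c) p ≡ heightAt xs p
  sweep-covers [] gl c p with sum gl ≟ 0
  ... | yes _ = cleared-cover gl c p
  ... | no  _ = closedAll-cover (policy gl 0 nothing c) c p
  sweep-covers (x ∷ xs) gl c zero with sum gl ≟ x
  ... | yes gl≡x = trans (stay-cover-zero (sweep xs gl c) (sweep-aligned xs gl c)) gl≡x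
  ... | no  _    = change-cover-zero (sweep xs _ _) (policy-valid gl x _ c) (sweep-aligned xs _ _)
  sweep-covers (x ∷ xs) gl c (suc q) with sum gl ≟ x
  ... | yes _ = trans (stay-cover-suc (sweep xs gl c) q) (sweep-covers xs gl c q)
  ... | no  _ = trans (change-cover-suc (sweep xs _ _) (proj₁ (policy-valid gl x _ c)) (sweep-aligned xs _ _) q)
                      (sweep-covers xs _ _ q)

  sweep-fits : ∀ xs gl c → ResultFits (length xs) (sweep xs gl c)
  sweep-fits [] gl c with sum gl ≟ 0
  ... | yes _ = cleared-fits gl c
  ... | no  _ = closedAll-fits c (proj₁ (policy-valid gl 0 nothing c))
  sweep-fits (x ∷ xs) gl c with sum gl ≟ x
  ... | yes _ = stay-fits (sweep xs gl c) (sweep-fits xs gl c)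
  ... | no  _ = change-fits (sweep xs _ _) (proj₁ (policy-valid gl x _ c)) (sweep-fits xs _ _)

  occ-recordClosing : ∀ k c rp → occ k (concat rp) + occ k (closed c) ≡ occ k (closed (recordClosing c rp))
  occ-recordClosing k c rp = trans (+-comm (occ k (concat rp)) _) (sym (occ-++ k (closed c) (concat rp)))

  sweep-values : ∀ k xs gl c → occ k (values (sweep xs gl c)) + occ k (closed c) ≡ occ k (closed (final (sweep xs gl c)))
  sweep-values k [] gl c with sum gl ≟ 0
  ... | yes _ = cong (λ vs → occ k vs + occ k (closed c)) (cleared-values gl c)
  ... | no  _ = trans (cong (λ vs → occ k vs + occ k (closed c)) (closedAll-values rp c)) (occ-recordClosing k c rp)
    where
    rp : Closing
    rp = policy gl 0 nothing c
  sweep-values k (x ∷ xs) gl c with sum gl ≟ x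
  ... | yes _ = trans (cong (λ vs → occ k vs + occ k (closed c)) (stay-values (sweep xs gl c))) (sweep-values k xs gl c)
  ... | no  _ = begin
    occ k (values (change rp o)) + occ k (closed c)
      ≡⟨ cong (_+ occ k (closed c)) (change-values k o (proj₁ (policy-valid gl x _ c)) (sweep-aligned xs _ _)) ⟩
    (occ k (values o) + occ k (concat rp)) + occ k (closed c)
      ≡⟨ +-assoc (occ k (values o)) _ _ ⟩
    occ k (values o) + (occ k (concat rp) + occ k (closed c))
      ≡⟨ cong (occ k (values o) +_) (occ-recordClosing k c rp) ⟩
    occ k (values o) + occ k (closed (recordClosing c rp))
      ≡⟨ sweep-values k xs (reopen gl rp x) (recordClosing c rp) ⟩
    occ k (closed (final o)) ∎
    where
    open ≡-Reasoning
    rp : Closing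
    rp = policy gl x (proj₁ (ahead x xs)) c
    o : Result
    o = sweep xs (reopen gl rp x) (recordClosing c rp)

  sweep-changes : ∀ xs gl c → changes (final (sweep xs gl c)) ≡ changes c + changeCount (sum gl) xs
  sweep-changes [] gl c with sum gl ≟ 0
  ... | yes gl≡0 = sym (trans (cong (changes c +_) (differ-≡ gl≡0)) (+-identityʳ _))
  ... | no  gl≢0 = sym (trans (cong (changes c +_) (differ-≢ gl≢0)) (+-comm (changes c) 1))
  sweep-changes (x ∷ xs) gl c with sum gl ≟ x
  ... | yes gl≡x =
    trans (sweep-changes xs gl c)
          (cong (changes c +_) (sym (cong₂ _+_ (differ-≡ gl≡x) (cong (λ h → changeCount h xs) (sym gl≡x)))))
  ... | no  gl≢x = begin
    changes (final (sweep xs (reopen gl rp x) (recordClosing c rp)))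
      ≡⟨ sweep-changes xs (reopen gl rp x) (recordClosing c rp) ⟩
    suc (changes c) + changeCount (sum (reopen gl rp x)) xs
      ≡⟨ cong (λ h → suc (changes c) + changeCount h xs) (reopen-sum (policy-valid gl x _ c)) ⟩
    suc (changes c) + changeCount x xs
      ≡⟨ sym (+-suc (changes c) _) ⟩
    changes c + (1 + changeCount x xs)
      ≡⟨ cong (λ d → changes c + (d + changeCount x xs)) (sym (differ-≢ gl≢x)) ⟩
    changes c + (differ (sum gl) x + changeCount x xs) ∎
    where
    open ≡-Reasoning
    rp : Closing
    rp = policy gl x (proj₁ (ahead x xs)) c

  run : ∀ {n} → Row n → Result
  run R = sweep (rowList R) [] noTally

  run-segmentation : ∀ {n} (R : Row n) →
    Σ[ ss ∈ List (Segment n) ] (IsSegmentation R ss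
      × (∀ k → countValue k ss ≡ occ k (closed (final (run R))))
      × changes (final (run R)) ≡ markers R)
  run-segmentation {n} R =
    toSegments (spans o) S-fits , covers , counts ,
    trans (sweep-changes (rowList R) [] noTally) (sym (markers-changeCount R))
    where
    open ≡-Reasoning
    o : Result
    o = run R

    no-pieces : pieces o ≡ []
    no-pieces = aligned-nothing (sweep-aligned (rowList R) [] noTally)

    S-fits : All (SpanFits n) (spans o)
    S-fits = subst (λ m → All (SpanFits m) (spans o)) (length-rowList R) (proj₁ (sweep-fits (rowList R) [] noTally))

    covers : IsSegmentation R (toSegments (spans o) S-fits)
    covers i = begin
      sumSegs (toSegments (spans o) S-fits) i              ≡⟨ toSegments-sum (spans o) S-fits i ⟩
      coverage (spans o) (toℕ i)                           ≡⟨ sym (+-identityʳ _) ⟩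
      coverage (spans o) (toℕ i) + pieceCover [] (toℕ i)   ≡⟨ cong (λ P → coverage (spans o) (toℕ i) + pieceCover P (toℕ i))
                                                                   (sym no-pieces) ⟩
      covered o (toℕ i)                                    ≡⟨ sweep-covers (rowList R) [] noTally (toℕ i) ⟩
      heightAt (rowList R) (toℕ i)                         ≡⟨ heightAt-rowList R i ⟩
      R i                                                  ∎

    counts : ∀ k → countValue k (toSegments (spans o) S-fits) ≡ occ k (closed (final o))
    counts k = begin
      countValue k (toSegments (spans o) S-fits) ≡⟨ toSegments-count k (spans o) S-fits ⟩
      occ k (map val (spans o))                  ≡⟨ cong (occ k) (sym (++-identityʳ (map val (spans o)))) ⟩
      occ k (map val (spans o) ++ [])            ≡⟨ cong (λ P → occ k (map val (spans o) ++ concat (map valuesOf P)))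
                                                         (sym no-pieces) ⟩
      occ k (values o)                           ≡⟨ sym (+-identityʳ _) ⟩
      occ k (values o) + occ k []                ≡⟨ sweep-values k (rowList R) [] noTally ⟩
      occ k (closed (final o))                   ∎

-- A move: offsets t₁, t₂, t₃ of the three potentials and, for each nonzero
-- open group (newest first), the values closed from it.
record Move : Set where
  constructor move
  field
    t₁ t₂ t₃ : ℕ
    action   : List (List ℕ)
open Move

-- The segment values, and per value the offset of a move's potential and
-- the budget it must stay within.
segmentValues : List ℕ
segmentValues = 1 ∷ 2 ∷ 3 ∷ []

slack : Move → ℕ → ℕ
slack e 1 = t₁ e
slack e 2 = t₂ e
slack e _ = t₃ e

budget : ℕ → ℕ
budget 1 = 6
budget 2 = 0
budget _ = 2

Affordable : Tally → Move → Set
Affordable c e = All (λ v → slack e v + 2 * v * occ v (closed c) ≤ budget v + changes c) segmentValues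

affordable? : ∀ c e → Dec (Affordable c e)
affordable? c e = all? (λ v → slack e v + 2 * v * occ v (closed c) ≤? budget v + changes c) segmentValues

-- The move e′ may follow e after the values fl are closed: each potential
-- grows by at most one, which the new height change pays for.
Follows : Move → List ℕ → Move → Set
Follows e fl e′ = All (λ v → slack e′ v + 2 * v * occ v fl ≤ suc (slack e v)) segmentValues

follows? : ∀ e fl e′ → Dec (Follows e fl e′)
follows? e fl e′ = all? (λ v → slack e′ v + 2 * v * occ v fl ≤? suc (slack e v)) segmentValues

potential-step : ∀ m K a b c d r → a + m * c ≤ K + r → b + m * d ≤ suc a → b + m * (c + d) ≤ K + suc r
potential-step m K a b c d r old new = begin
  b + m * (c + d)       ≡⟨ cong (b +_) (*-distribˡ-+ m c d) ⟩
  b + (m * c + m * d)   ≡⟨ cong (b +_) (+-comm (m * c) (m * d)) ⟩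
  b + (m * d + m * c)   ≡⟨ sym (+-assoc b (m * d) (m * c)) ⟩
  (b + m * d) + m * c   ≤⟨ +-monoˡ-≤ (m * c) new ⟩
  suc a + m * c         ≤⟨ s≤s old ⟩
  suc (K + r)           ≡⟨ sym (+-suc K r) ⟩
  K + suc r             ∎
  where open ≤-Reasoning

step-affordable : ∀ c rp {e e′} → Affordable c e → Follows e (concat rp) e′ → Affordable (recordClosing c rp) e′
step-affordable c rp {e} {e′} aff fol = All.zipWith step (aff , fol)
  where
  step : ∀ {v} → (slack e v + 2 * v * occ v (closed c) ≤ budget v + changes c)
                × (slack e′ v + 2 * v * occ v (concat rp) ≤ suc (slack e v))
         → slack e′ v + 2 * v * occ v (closed c ++ concat rp) ≤ budget v + suc (changes c)
  step {v} (old , new) =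
    subst (λ n → slack e′ v + 2 * v * n ≤ budget v + suc (changes c)) (sym (occ-++ v (closed c) (concat rp)))
          (potential-step (2 * v) (budget v) _ _ (occ v (closed c)) (occ v (concat rp)) (changes c) old new)

-- The final pseudo-move; affording it gives the bounds of the theorem.
done : Move
done = move 0 0 2 []

done-bounds : ∀ c → Affordable c done →
  2 * occ 1 (closed c) ≤ changes c + 6 × 4 * occ 2 (closed c) ≤ changes c × 6 * occ 3 (closed c) ≤ changes c
done-bounds c (b₁ ∷ b₂ ∷ b₃ ∷ []) =
  subst (2 * occ 1 (closed c) ≤_) (+-comm 6 (changes c)) b₁ , b₂ , +-cancelˡ-≤ 2 _ _ b₃

-- Tables only mention the nonzero groups; a move's action is spread over
-- all groups, zero groups closing nothing.
nonzero : Groups → Groups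
nonzero []           = []
nonzero (zero  ∷ gl) = nonzero gl
nonzero (suc a ∷ gl) = suc a ∷ nonzero gl

spread : Groups → List (List ℕ) → Closing
spread []           act       = []
spread (zero  ∷ gl) act       = [] ∷ spread gl act
spread (suc a ∷ gl) []        = [] ∷ spread gl []
spread (suc a ∷ gl) (r ∷ act) = r ∷ spread gl act

nonzero-∷ : ∀ a {L L′} → nonzero L ≡ nonzero L′ → nonzero (a ∷ L) ≡ nonzero (a ∷ L′)
nonzero-∷ zero    eq = eq
nonzero-∷ (suc a) eq = cong (suc a ∷_) eq

sum-nonzero : ∀ L → sum (nonzero L) ≡ sum L
sum-nonzero []          = refl
sum-nonzero (zero  ∷ L) = sum-nonzero L
sum-nonzero (suc a ∷ L) = cong (suc a +_) (sum-nonzero L)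

spread-fits : ∀ gl act → Fits (nonzero gl) (spread (nonzero gl) act) → Fits gl (spread gl act)
spread-fits []           act       fits       = fits
spread-fits (zero  ∷ gl) act       fits       = (z≤n , []) ∷ spread-fits gl act fits
spread-fits (suc a ∷ gl) []        (f ∷ fits) = f ∷ spread-fits gl [] fits
spread-fits (suc a ∷ gl) (r ∷ act) (f ∷ fits) = f ∷ spread-fits gl act fits

spread-remainders : ∀ gl act →
  nonzero (remainders gl (spread gl act)) ≡ nonzero (remainders (nonzero gl) (spread (nonzero gl) act))
spread-remainders []           act       = refl
spread-remainders (zero  ∷ gl) act       = spread-remainders gl act
spread-remainders (suc a ∷ gl) []        = cong (suc a ∷_) (spread-remainders gl [])
spread-remainders (suc a ∷ gl) (r ∷ act) = nonzero-∷ (suc a ∸ sum r) (spread-remainders gl act)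

spread-concat : ∀ gl act → concat (spread gl act) ≡ concat (spread (nonzero gl) act)
spread-concat []           act       = refl
spread-concat (zero  ∷ gl) act       = spread-concat gl act
spread-concat (suc a ∷ gl) []        = spread-concat gl []
spread-concat (suc a ∷ gl) (r ∷ act) = cong (r ++_) (spread-concat gl act)

spread-remainders-sum : ∀ gl act →
  sum (remainders (nonzero gl) (spread (nonzero gl) act)) ≡ sum (remainders gl (spread gl act))
spread-remainders-sum gl act =
  trans (sym (sum-nonzero (remainders (nonzero gl) (spread (nonzero gl) act))))
        (trans (cong sum (sym (spread-remainders gl act))) (sum-nonzero (remainders gl (spread gl act))))

spread-valid : ∀ gl act {x} → ValidClosing (nonzero gl) (spread (nonzero gl) act) x → ValidClosing gl (spread gl act) x
spread-valid gl act (fits , rest≤x) = spread-fits gl act fits , subst (_≤ _) (spread-remainders-sum gl act) rest≤x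

spread-reopen : ∀ gl act x →
  nonzero (reopen gl (spread gl act) x) ≡ nonzero (reopen (nonzero gl) (spread (nonzero gl) act) x)
spread-reopen gl act x =
  trans (cong (λ s → nonzero ((x ∸ s) ∷ remainders gl (spread gl act))) (sym (spread-remainders-sum gl act)))
        (nonzero-∷ (x ∸ sum (remainders (nonzero gl) (spread (nonzero gl) act))) (spread-remainders gl act))

-- The moves offered when the nonzero open groups are `key`, the height
-- changes to `height`, and the height after it is `next` (`nothing`: the row
-- has ended).
record Node : Set where
  constructor node
  field
    key    : Groups
    height : ℕ
    next   : Maybe ℕ
    moves  : List Move

at? : ∀ (n : Node) k x y → Dec (Node.key n ≡ k × Node.height n ≡ x × Node.next n ≡ y)
at? n k x y = ≡-dec _≟_ (Node.key n) k ×-dec (Node.height n ≟ x) ×-dec Maybe.≡-dec _≟_ (Node.next n) y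

movesIn : List Node → Groups → ℕ → Maybe ℕ → List Move
movesIn []      k x y = []
movesIn (n ∷ t) k x y with at? n k x y
... | yes _ = Node.moves n
... | no  _ = movesIn t k x y

movesIn-all : ∀ (P : Groups → ℕ → Maybe ℕ → Move → Set) t →
  All (λ n → All (P (Node.key n) (Node.height n) (Node.next n)) (Node.moves n)) t →
  ∀ k x y → All (P k x y) (movesIn t k x y)
movesIn-all P []      []         k x y = []
movesIn-all P (n ∷ t) (ok ∷ oks) k x y with at? n k x y
... | yes (refl , refl , refl) = ok
... | no  _                    = movesIn-all P t oks k x y

-- The heights that can follow height h among the distinct heights of a row
-- with entries at most 3: any other height, and the end after 0.
endAfter : ℕ → List (Maybe ℕ)
endAfter zero    = nothing ∷ []
endAfter (suc _) = []

successors : Maybe ℕ → List (Maybe ℕ)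
successors nothing  = nothing ∷ []
successors (just h) = map just (filter (λ z → ¬? (z ≟ h)) (upTo 4)) ++ endAfter h

successor : ∀ {x h} → x ≤ 3 → x ≢ h → just x ∈ successors (just h)
successor {h = h} x≤3 x≢h = ∈-++⁺ˡ (∈-map⁺ just (∈-filter⁺ (λ z → ¬? (z ≟ h)) (∈-upTo⁺ (s≤s x≤3)) x≢h))

ahead-successor : ∀ h xs → All (_≤ 3) xs → proj₁ (ahead h xs) ∈ successors (just h)
ahead-successor h [] _ with h ≟ 0
... | yes refl = ∈-++⁺ʳ (map just (filter (λ z → ¬? (z ≟ 0)) (upTo 4))) (here refl)
... | no  h≢0  = successor z≤n (h≢0 ∘ sym)
ahead-successor h (x ∷ xs) (x≤3 ∷ xs≤3) with h ≟ x
... | yes _   = ahead-successor h xs xs≤3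
... | no  h≢x = successor x≤3 (h≢x ∘ sym)

following-successor : ∀ h xs → All (_≤ 3) xs → following (ahead h xs) ∈ successors (proj₁ (ahead h xs))
following-successor h [] _ with h ≟ 0
... | yes _ = here refl
... | no  _ = ∈-++⁺ʳ (map just (filter (λ z → ¬? (z ≟ 0)) (upTo 4))) (here refl)
following-successor h (x ∷ xs) (_ ∷ xs≤3) with h ≟ x
... | yes _ = following-successor h xs xs≤3
... | no  _ = ahead-successor x xs xs≤3

module Table (table : List Node) where

  -- The moves available for the next two distinct heights X, Y; once the
  -- row has ended only `done` remains.
  options : Groups → Maybe ℕ → Maybe ℕ → List Move
  options k nothing  _ = done ∷ []
  options k (just x) y = movesIn table k x y

  closingOf : Groups → Move → Closing
  closingOf k e = spread k (action e)

  MoveOK : Groups → ℕ → Maybe ℕ → Move → Set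
  MoveOK k x y e =
    ValidClosing k (closingOf k e) x
    × All (λ z → Any (Follows e (concat (closingOf k e))) (options (nonzero (reopen k (closingOf k e) x)) y z))
          (successors y)

  moveOK? : ∀ k x y e → Dec (MoveOK k x y e)
  moveOK? k x y e =
    validClosing? k (closingOf k e) x
    ×-dec all? (λ z → any? (follows? e (concat (closingOf k e))) (options (nonzero (reopen k (closingOf k e) x)) y z))
               (successors y)

  Certified : Set
  Certified = All (λ n → All (MoveOK (Node.key n) (Node.height n) (Node.next n)) (Node.moves n)) table

  certified? : Dec Certified
  certified? = all? (λ n → all? (moveOK? (Node.key n) (Node.height n) (Node.next n)) (Node.moves n)) table

  Initial : Set
  Initial = All (λ X → All (λ Y → Any (Affordable noTally) (options [] X Y)) (successors X)) (successors (just 0))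

  initial? : Dec Initial
  initial? = all? (λ X → all? (λ Y → any? (affordable? noTally) (options [] X Y)) (successors X)) (successors (just 0))

  module Play (certified : Certified) (initial : Initial) where

    sound : ∀ k x y → All (MoveOK k x y) (movesIn table k x y)
    sound = movesIn-all MoveOK table certified

    policy : Groups → ℕ → Maybe ℕ → Tally → Closing
    policy gl x y c with any? (affordable? c) (movesIn table (nonzero gl) x y)
    ... | yes a = spread gl (action (Any.lookup a))
    ... | no  _ = closeAll gl

    policy-valid : ∀ gl x y c → ValidClosing gl (policy gl x y c) x
    policy-valid gl x y c with any? (affordable? c) (movesIn table (nonzero gl) x y)
    ... | yes a = spread-valid gl _ (proj₁ (proj₁ (lookupAny (sound (nonzero gl) x y) a)))
    ... | no  _ = closeAll-valid gl x

    chosen : ∀ {gl x y c} → Any (Affordable c) (movesIn table (nonzero gl) x y) →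
      Σ[ e ∈ Move ] (Affordable c e × MoveOK (nonzero gl) x y e × policy gl x y c ≡ spread gl (action e))
    chosen {gl} {x} {y} {c} a with any? (affordable? c) (movesIn table (nonzero gl) x y)
    ... | yes a′ = Any.lookup a′ , proj₂ (lookupAny (sound _ x y) a′) , proj₁ (lookupAny (sound _ x y) a′) , refl
    ... | no ¬a  = ⊥-elim (¬a a)

    open Sweep policy policy-valid public

    Invariant : Groups → List ℕ → Tally → Set
    Invariant gl xs c =
      Any (Affordable c) (options (nonzero gl) (proj₁ (ahead (sum gl) xs)) (following (ahead (sum gl) xs)))

    invariant-start : ∀ xs → All (_≤ 3) xs → Invariant [] xs noTally
    invariant-start xs xs≤3 =
      All.lookup (All.lookup initial (ahead-successor 0 xs xs≤3)) (following-successor 0 xs xs≤3)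

    invariant-step : ∀ {gl x xs c e} → All (_≤ 3) xs → Affordable c e → MoveOK (nonzero gl) x (proj₁ (ahead x xs)) e →
      Invariant (reopen gl (spread gl (action e)) x) xs (recordClosing c (spread gl (action e)))
    invariant-step {gl} {x} {xs} {c} {e} xs≤3 aff (valid , continue) =
      subst₂ (λ k h → Any (Affordable (recordClosing c rp)) (options k (proj₁ (ahead h xs)) (following (ahead h xs))))
             (sym (spread-reopen gl (action e) x)) (sym (reopen-sum (spread-valid gl (action e) valid)))
             (Any.map (step-affordable c rp aff ∘ subst (λ fl → Follows e fl _) (sym (spread-concat gl (action e))))
                      (All.lookup continue (following-successor x xs xs≤3)))
      where
      rp : Closing
      rp = spread gl (action e)

    sweep-affordable : ∀ xs gl c → All (_≤ 3) xs → Invariant gl xs c → Affordable (final (sweep xs gl c)) done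
    sweep-affordable [] gl c _ inv with sum gl ≟ 0
    ... | yes _ = Any-singleton⁻ inv
    ... | no  _ with chosen inv
    ...   | e , aff , (_ , continue) , policy≡ =
      subst (λ rp → Affordable (recordClosing c rp) done) (sym policy≡)
            (step-affordable c (spread gl (action e)) aff
               (subst (λ fl → Follows e fl done) (sym (spread-concat gl (action e))) (Any-singleton⁻ (All.head continue))))
    sweep-affordable (x ∷ xs) gl c (_ ∷ xs≤3) inv with sum gl ≟ x
    ... | yes _ = sweep-affordable xs gl c xs≤3 inv
    ... | no  _ with chosen inv
    ...   | e , aff , ok , policy≡ =
      subst (λ rp → Affordable (final (sweep xs (reopen gl rp x) (recordClosing c rp))) done) (sym policy≡)
            (sweep-affordable xs (reopen gl rp x) (recordClosing c rp) xs≤3 (invariant-step {gl} {x} {xs} {c} xs≤3 aff ok))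
      where
      rp : Closing
      rp = spread gl (action e)

    run-affordable : ∀ {n} (R : Row n) → (∀ i → R i ≤ 3) → Affordable (final (run R)) done
    run-affordable R R≤3 = sweep-affordable (rowList R) [] noTally bounded (invariant-start (rowList R) bounded)
      where
      bounded : All (_≤ 3) (rowList R)
      bounded = rowList-bounded R R≤3

-- A table found by a computer search; the type checker verifies that it is
-- certified and covers the start of every row.
strategy : List Node
strategy =
    node [] 1 (just 0) (move 0 1 5 [] ∷ move 1 2 2 [] ∷ move 2 0 2 [] ∷ move 2 2 0 [] ∷ move 4 0 0 [] ∷ [])
  ∷ node [] 1 (just 2) (move 0 3 7 [] ∷ move 1 0 6 [] ∷ move 1 2 3 [] ∷ move 1 3 2 [] ∷ move 3 0 1 [] ∷ move 3 1 0 [] ∷ [])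
  ∷ node [] 1 (just 3) (move 0 1 7 [] ∷ move 1 1 5 [] ∷ move 1 2 3 [] ∷ move 1 3 1 [] ∷ move 3 0 4 [] ∷ move 3 1 1 [] ∷ move 3 3 0 [] ∷ move 5 0 1 [] ∷ move 5 1 0 [] ∷ [])
  ∷ node [] 2 (just 0) (move 0 3 4 [] ∷ move 0 4 2 [] ∷ move 1 2 4 [] ∷ move 2 1 5 [] ∷ move 2 2 2 [] ∷ move 2 4 0 [] ∷ move 3 0 4 [] ∷ move 4 0 2 [] ∷ move 4 2 0 [] ∷ [])
  ∷ node [] 2 (just 1) (move 0 3 6 [] ∷ move 1 2 3 [] ∷ move 1 3 2 [] ∷ move 2 0 5 [] ∷ move 3 0 2 [] ∷ move 3 2 0 [] ∷ [])
  ∷ node [] 2 (just 3) (move 0 3 3 [] ∷ move 1 2 3 [] ∷ move 1 3 1 [] ∷ move 2 1 3 [] ∷ move 3 0 4 [] ∷ move 3 1 1 [] ∷ move 3 3 0 [] ∷ move 5 0 1 [] ∷ move 5 1 0 [] ∷ [])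
  ∷ node [] 3 (just 0) (move 0 2 6 [] ∷ move 1 4 4 [] ∷ move 2 0 6 [] ∷ move 2 2 4 [] ∷ move 2 4 2 [] ∷ move 4 0 4 [] ∷ move 4 2 2 [] ∷ move 4 4 0 [] ∷ move 6 0 2 [] ∷ move 6 2 0 [] ∷ [])
  ∷ node [] 3 (just 1) (move 0 2 7 [] ∷ move 1 2 6 [] ∷ move 1 4 2 [] ∷ move 2 1 6 [] ∷ move 2 2 4 [] ∷ move 3 0 6 [] ∷ move 3 2 2 [] ∷ move 3 4 0 [] ∷ move 4 0 4 [] ∷ move 5 0 2 [] ∷ move 5 2 0 [] ∷ [])
  ∷ node [] 3 (just 2) (move 0 3 7 [] ∷ move 1 2 5 [] ∷ move 1 3 4 [] ∷ move 1 4 2 [] ∷ move 2 1 3 [] ∷ move 3 0 4 [] ∷ move 3 1 2 [] ∷ move 3 3 0 [] ∷ move 5 0 1 [] ∷ move 5 1 0 [] ∷ [])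
  ∷ node (1 ∷ []) 0 (just 1) (move 1 2 6 ((1 ∷ []) ∷ []) ∷ move 2 0 5 ((1 ∷ []) ∷ []) ∷ move 2 1 2 ((1 ∷ []) ∷ []) ∷ move 2 2 1 ((1 ∷ []) ∷ []) ∷ move 4 0 1 ((1 ∷ []) ∷ []) ∷ [])
  ∷ node (1 ∷ []) 0 (just 2) (move 1 2 5 ((1 ∷ []) ∷ []) ∷ move 2 1 3 ((1 ∷ []) ∷ []) ∷ move 2 3 1 ((1 ∷ []) ∷ []) ∷ move 3 0 4 ((1 ∷ []) ∷ []) ∷ move 4 0 3 ((1 ∷ []) ∷ []) ∷ move 4 1 1 ((1 ∷ []) ∷ []) ∷ [])
  ∷ node (1 ∷ []) 0 (just 3) (move 1 2 6 ((1 ∷ []) ∷ []) ∷ move 2 1 5 ((1 ∷ []) ∷ []) ∷ move 2 3 3 ((1 ∷ []) ∷ []) ∷ move 3 0 5 ((1 ∷ []) ∷ []) ∷ move 3 1 3 ((1 ∷ []) ∷ []) ∷ move 3 3 1 ((1 ∷ []) ∷ []) ∷ move 5 0 3 ((1 ∷ []) ∷ []) ∷ move 5 1 1 ((1 ∷ []) ∷ []) ∷ [])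
  ∷ node (1 ∷ []) 0 nothing (move 1 0 1 ((1 ∷ []) ∷ []) ∷ [])
  ∷ node (1 ∷ []) 2 (just 0) (move 1 4 4 ((1 ∷ []) ∷ []) ∷ move 2 1 5 ([] ∷ []) ∷ move 2 3 4 ((1 ∷ []) ∷ []) ∷ move 2 4 2 ((1 ∷ []) ∷ []) ∷ move 3 0 4 ([] ∷ []) ∷ move 3 2 2 ([] ∷ []) ∷ move 4 0 2 ([] ∷ []) ∷ move 4 2 0 ([] ∷ []) ∷ [])
  ∷ node (1 ∷ []) 2 (just 1) (move 1 2 6 ([] ∷ []) ∷ move 2 1 2 ([] ∷ []) ∷ move 2 2 1 ([] ∷ []) ∷ move 3 0 2 ([] ∷ []) ∷ move 3 2 0 ([] ∷ []) ∷ [])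
  ∷ node (1 ∷ []) 2 (just 3) (move 1 4 8 ((1 ∷ []) ∷ []) ∷ move 2 1 7 ([] ∷ []) ∷ move 2 3 3 ((1 ∷ []) ∷ []) ∷ move 3 0 4 ([] ∷ []) ∷ move 3 2 3 ([] ∷ []) ∷ move 3 3 1 ((1 ∷ []) ∷ []) ∷ move 4 0 3 ([] ∷ []) ∷ move 4 1 1 ([] ∷ []) ∷ move 5 0 1 ([] ∷ []) ∷ move 5 1 0 ([] ∷ []) ∷ [])
  ∷ node (1 ∷ []) 3 (just 0) (move 1 2 8 ((1 ∷ []) ∷ []) ∷ move 1 4 4 ([] ∷ []) ∷ move 2 0 8 ((1 ∷ []) ∷ []) ∷ move 2 2 6 ((1 ∷ []) ∷ []) ∷ move 2 3 4 ([] ∷ []) ∷ move 2 4 2 ([] ∷ []) ∷ move 3 2 4 ([] ∷ []) ∷ move 4 0 6 ((1 ∷ []) ∷ []) ∷ move 4 1 5 ([] ∷ []) ∷ move 4 2 2 ([] ∷ []) ∷ move 4 4 0 ([] ∷ []) ∷ move 6 0 2 ([] ∷ []) ∷ move 6 2 0 ([] ∷ []) ∷ [])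
  ∷ node (1 ∷ []) 3 (just 1) (move 1 2 6 ([] ∷ []) ∷ move 1 4 2 ([] ∷ []) ∷ move 2 1 8 ((1 ∷ []) ∷ []) ∷ move 2 2 4 ([] ∷ []) ∷ move 3 0 8 ((1 ∷ []) ∷ []) ∷ move 3 4 0 ([] ∷ []) ∷ move 4 0 5 ([] ∷ []) ∷ move 4 1 2 ([] ∷ []) ∷ move 4 2 1 ([] ∷ []) ∷ [])
  ∷ node (1 ∷ []) 3 (just 2) (move 1 2 5 ([] ∷ []) ∷ move 1 3 4 ([] ∷ []) ∷ move 1 4 2 ([] ∷ []) ∷ move 2 1 3 ([] ∷ []) ∷ move 3 0 4 ([] ∷ []) ∷ move 3 1 2 ([] ∷ []) ∷ move 3 2 1 ([] ∷ []) ∷ move 3 3 0 ([] ∷ []) ∷ [])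
  ∷ node (1 ∷ 1 ∷ []) 0 (just 1) (move 3 2 6 ((1 ∷ []) ∷ (1 ∷ []) ∷ []) ∷ move 4 1 2 ((1 ∷ []) ∷ (1 ∷ []) ∷ []) ∷ move 4 2 1 ((1 ∷ []) ∷ (1 ∷ []) ∷ []) ∷ [])
  ∷ node (1 ∷ 1 ∷ []) 0 (just 2) (move 3 2 5 ((1 ∷ []) ∷ (1 ∷ []) ∷ []) ∷ move 4 1 3 ((1 ∷ []) ∷ (1 ∷ []) ∷ []) ∷ move 4 3 1 ((1 ∷ []) ∷ (1 ∷ []) ∷ []) ∷ [])
  ∷ node (1 ∷ 1 ∷ []) 0 (just 3) (move 3 2 6 ((1 ∷ []) ∷ (1 ∷ []) ∷ []) ∷ move 4 1 5 ((1 ∷ []) ∷ (1 ∷ []) ∷ []) ∷ move 4 3 3 ((1 ∷ []) ∷ (1 ∷ []) ∷ []) ∷ move 5 1 3 ((1 ∷ []) ∷ (1 ∷ []) ∷ []) ∷ move 5 3 1 ((1 ∷ []) ∷ (1 ∷ []) ∷ []) ∷ [])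
  ∷ node (1 ∷ 1 ∷ []) 0 nothing (move 3 0 1 ((1 ∷ []) ∷ (1 ∷ []) ∷ []) ∷ [])
  ∷ node (1 ∷ 1 ∷ []) 1 (just 0) (move 2 1 5 ([] ∷ (1 ∷ []) ∷ []) ∷ move 3 0 4 ([] ∷ (1 ∷ []) ∷ []) ∷ move 3 2 2 ([] ∷ (1 ∷ []) ∷ []) ∷ move 4 0 2 ([] ∷ (1 ∷ []) ∷ []) ∷ move 4 2 0 ([] ∷ (1 ∷ []) ∷ []) ∷ [])
  ∷ node (1 ∷ 1 ∷ []) 1 (just 2) (move 2 3 7 ([] ∷ (1 ∷ []) ∷ []) ∷ move 3 0 6 ([] ∷ (1 ∷ []) ∷ []) ∷ move 3 2 3 ([] ∷ (1 ∷ []) ∷ []) ∷ move 3 3 2 ([] ∷ (1 ∷ []) ∷ []) ∷ move 4 0 3 ([] ∷ (1 ∷ []) ∷ []) ∷ move 4 2 1 ([] ∷ (1 ∷ []) ∷ []) ∷ [])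
  ∷ node (1 ∷ 1 ∷ []) 1 (just 3) (move 2 1 7 ([] ∷ (1 ∷ []) ∷ []) ∷ move 3 0 7 ([] ∷ (1 ∷ []) ∷ []) ∷ move 3 1 5 ([] ∷ (1 ∷ []) ∷ []) ∷ move 3 2 3 ([] ∷ (1 ∷ []) ∷ []) ∷ move 3 3 1 ([] ∷ (1 ∷ []) ∷ []) ∷ move 4 1 3 ([] ∷ (1 ∷ []) ∷ []) ∷ [])
  ∷ node (1 ∷ 1 ∷ []) 3 (just 0) (move 3 2 8 ((1 ∷ []) ∷ (1 ∷ []) ∷ []) ∷ move 4 1 5 ([] ∷ [] ∷ []) ∷ move 4 3 4 ([] ∷ (1 ∷ []) ∷ []) ∷ move 4 4 2 ([] ∷ (1 ∷ []) ∷ []) ∷ move 5 0 4 ([] ∷ [] ∷ []) ∷ move 5 2 2 ([] ∷ [] ∷ []) ∷ move 6 0 2 ([] ∷ [] ∷ []) ∷ move 6 2 0 ([] ∷ [] ∷ []) ∷ [])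
  ∷ node (1 ∷ 1 ∷ []) 3 (just 1) (move 3 2 6 ([] ∷ (1 ∷ []) ∷ []) ∷ move 4 1 2 ([] ∷ [] ∷ []) ∷ move 4 2 1 ([] ∷ [] ∷ []) ∷ [])
  ∷ node (1 ∷ 1 ∷ []) 3 (just 2) (move 3 0 6 ([] ∷ [] ∷ []) ∷ move 4 1 2 ([] ∷ [] ∷ []) ∷ move 4 2 1 ([] ∷ [] ∷ []) ∷ [])
  ∷ node (1 ∷ 1 ∷ 1 ∷ []) 0 (just 1) (move 5 2 6 ((1 ∷ []) ∷ (1 ∷ []) ∷ (1 ∷ []) ∷ []) ∷ move 6 1 2 ((1 ∷ []) ∷ (1 ∷ []) ∷ (1 ∷ []) ∷ []) ∷ move 6 2 1 ((1 ∷ []) ∷ (1 ∷ []) ∷ (1 ∷ []) ∷ []) ∷ [])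
  ∷ node (1 ∷ 1 ∷ 1 ∷ []) 0 (just 2) (move 5 2 5 ((1 ∷ []) ∷ (1 ∷ []) ∷ (1 ∷ []) ∷ []) ∷ move 6 1 3 ((1 ∷ []) ∷ (1 ∷ []) ∷ (1 ∷ []) ∷ []) ∷ move 6 3 1 ((1 ∷ []) ∷ (1 ∷ []) ∷ (1 ∷ []) ∷ []) ∷ [])
  ∷ node (1 ∷ 1 ∷ 1 ∷ []) 0 (just 3) (move 5 2 6 ((1 ∷ []) ∷ (1 ∷ []) ∷ (1 ∷ []) ∷ []) ∷ move 6 1 5 ((1 ∷ []) ∷ (1 ∷ []) ∷ (1 ∷ []) ∷ []) ∷ move 6 3 3 ((1 ∷ []) ∷ (1 ∷ []) ∷ (1 ∷ []) ∷ []) ∷ move 7 1 3 ((1 ∷ []) ∷ (1 ∷ []) ∷ (1 ∷ []) ∷ []) ∷ move 7 3 1 ((1 ∷ []) ∷ (1 ∷ []) ∷ (1 ∷ []) ∷ []) ∷ [])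
  ∷ node (1 ∷ 1 ∷ 1 ∷ []) 0 nothing (move 5 0 1 ((1 ∷ []) ∷ (1 ∷ []) ∷ (1 ∷ []) ∷ []) ∷ [])
  ∷ node (1 ∷ 1 ∷ 1 ∷ []) 1 (just 0) (move 5 2 2 ([] ∷ (1 ∷ []) ∷ (1 ∷ []) ∷ []) ∷ [])
  ∷ node (1 ∷ 1 ∷ 1 ∷ []) 1 (just 2) (move 5 2 3 ([] ∷ (1 ∷ []) ∷ (1 ∷ []) ∷ []) ∷ move 5 3 2 ([] ∷ (1 ∷ []) ∷ (1 ∷ []) ∷ []) ∷ [])
  ∷ node (1 ∷ 1 ∷ 1 ∷ []) 1 (just 3) (move 5 2 3 ([] ∷ (1 ∷ []) ∷ (1 ∷ []) ∷ []) ∷ move 5 3 1 ([] ∷ (1 ∷ []) ∷ (1 ∷ []) ∷ []) ∷ [])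
  ∷ node (1 ∷ 1 ∷ 1 ∷ []) 2 (just 0) (move 4 1 5 ([] ∷ [] ∷ (1 ∷ []) ∷ []) ∷ move 5 2 2 ([] ∷ [] ∷ (1 ∷ []) ∷ []) ∷ [])
  ∷ node (1 ∷ 1 ∷ 1 ∷ []) 2 (just 1) (move 4 1 2 ([] ∷ [] ∷ (1 ∷ []) ∷ []) ∷ [])
  ∷ node (1 ∷ 1 ∷ 1 ∷ []) 2 (just 3) (move 4 1 7 ([] ∷ [] ∷ (1 ∷ []) ∷ []) ∷ move 5 2 3 ([] ∷ [] ∷ (1 ∷ []) ∷ []) ∷ move 5 3 1 ([] ∷ [] ∷ (1 ∷ []) ∷ []) ∷ [])
  ∷ node (1 ∷ 2 ∷ []) 0 (just 1) (move 2 4 5 ((1 ∷ []) ∷ (2 ∷ []) ∷ []) ∷ move 2 5 2 ((1 ∷ []) ∷ (2 ∷ []) ∷ []) ∷ move 4 3 3 ((1 ∷ []) ∷ (2 ∷ []) ∷ []) ∷ move 4 4 1 ((1 ∷ []) ∷ (2 ∷ []) ∷ []) ∷ move 5 2 6 ((1 ∷ []) ∷ (1 ∷ 1 ∷ []) ∷ []) ∷ move 6 1 2 ((1 ∷ []) ∷ (1 ∷ 1 ∷ []) ∷ []) ∷ move 6 2 1 ((1 ∷ []) ∷ (1 ∷ 1 ∷ []) ∷ []) ∷ [])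
  ∷ node (1 ∷ 2 ∷ []) 0 (just 2) (move 2 5 3 ((1 ∷ []) ∷ (2 ∷ []) ∷ []) ∷ move 3 4 4 ((1 ∷ []) ∷ (2 ∷ []) ∷ []) ∷ move 4 3 3 ((1 ∷ []) ∷ (2 ∷ []) ∷ []) ∷ move 4 5 1 ((1 ∷ []) ∷ (2 ∷ []) ∷ []) ∷ move 5 2 5 ((1 ∷ []) ∷ (1 ∷ 1 ∷ []) ∷ []) ∷ move 6 1 3 ((1 ∷ []) ∷ (1 ∷ 1 ∷ []) ∷ []) ∷ move 6 3 1 ((1 ∷ []) ∷ (2 ∷ []) ∷ []) ∷ [])
  ∷ node (1 ∷ 2 ∷ []) 0 (just 3) (move 2 5 5 ((1 ∷ []) ∷ (2 ∷ []) ∷ []) ∷ move 3 4 5 ((1 ∷ []) ∷ (2 ∷ []) ∷ []) ∷ move 3 5 3 ((1 ∷ []) ∷ (2 ∷ []) ∷ []) ∷ move 4 3 5 ((1 ∷ []) ∷ (2 ∷ []) ∷ []) ∷ move 5 2 6 ((1 ∷ []) ∷ (1 ∷ 1 ∷ []) ∷ []) ∷ move 5 3 3 ((1 ∷ []) ∷ (2 ∷ []) ∷ []) ∷ move 5 5 1 ((1 ∷ []) ∷ (2 ∷ []) ∷ []) ∷ move 7 1 3 ((1 ∷ []) ∷ (1 ∷ 1 ∷ []) ∷ []) ∷ move 7 3 1 ((1 ∷ []) ∷ (2 ∷ []) ∷ []) ∷ [])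
  ∷ node (1 ∷ 2 ∷ []) 0 nothing (move 1 3 1 ((1 ∷ []) ∷ (2 ∷ []) ∷ []) ∷ move 5 0 1 ((1 ∷ []) ∷ (1 ∷ 1 ∷ []) ∷ []) ∷ [])
  ∷ node (1 ∷ 2 ∷ []) 1 (just 0) (move 1 4 4 ([] ∷ (2 ∷ []) ∷ []) ∷ move 2 3 4 ([] ∷ (2 ∷ []) ∷ []) ∷ move 2 4 2 ([] ∷ (2 ∷ []) ∷ []) ∷ move 5 2 2 ([] ∷ (1 ∷ 1 ∷ []) ∷ []) ∷ [])
  ∷ node (1 ∷ 2 ∷ []) 1 (just 2) (move 1 4 6 ([] ∷ (2 ∷ []) ∷ []) ∷ move 2 3 3 ([] ∷ (2 ∷ []) ∷ []) ∷ move 2 5 2 ([] ∷ (2 ∷ []) ∷ []) ∷ move 3 3 2 ([] ∷ (2 ∷ []) ∷ []) ∷ move 5 2 3 ([] ∷ (1 ∷ 1 ∷ []) ∷ []) ∷ [])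
  ∷ node (1 ∷ 2 ∷ []) 1 (just 3) (move 1 4 7 ([] ∷ (2 ∷ []) ∷ []) ∷ move 2 5 3 ([] ∷ (2 ∷ []) ∷ []) ∷ move 3 3 5 ([] ∷ (2 ∷ []) ∷ []) ∷ move 3 5 1 ([] ∷ (2 ∷ []) ∷ []) ∷ move 5 2 3 ([] ∷ (1 ∷ 1 ∷ []) ∷ []) ∷ move 5 3 1 ([] ∷ (1 ∷ 1 ∷ []) ∷ []) ∷ [])
  ∷ node (1 ∷ 2 ∷ []) 2 (just 0) (move 1 4 4 ((1 ∷ []) ∷ [] ∷ []) ∷ move 2 4 2 ((1 ∷ []) ∷ [] ∷ []) ∷ move 4 2 2 ((1 ∷ []) ∷ [] ∷ []) ∷ [])
  ∷ node (1 ∷ 2 ∷ []) 2 (just 1) (move 2 4 5 ([] ∷ (2 ∷ []) ∷ []) ∷ move 3 2 3 ((1 ∷ []) ∷ [] ∷ []) ∷ move 3 3 2 ((1 ∷ []) ∷ [] ∷ []) ∷ [])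
  ∷ node (1 ∷ 2 ∷ []) 2 (just 3) (move 2 3 3 ((1 ∷ []) ∷ [] ∷ []) ∷ move 3 2 3 ((1 ∷ []) ∷ [] ∷ []) ∷ move 3 3 1 ((1 ∷ []) ∷ [] ∷ []) ∷ [])
  ∷ node (2 ∷ []) 0 (just 1) (move 0 4 5 ((2 ∷ []) ∷ []) ∷ move 0 5 2 ((2 ∷ []) ∷ []) ∷ move 2 3 3 ((2 ∷ []) ∷ []) ∷ move 2 4 1 ((2 ∷ []) ∷ []) ∷ move 3 2 6 ((1 ∷ 1 ∷ []) ∷ []) ∷ move 4 1 2 ((1 ∷ 1 ∷ []) ∷ []) ∷ move 4 2 1 ((1 ∷ 1 ∷ []) ∷ []) ∷ [])
  ∷ node (2 ∷ []) 0 (just 2) (move 0 5 3 ((2 ∷ []) ∷ []) ∷ move 1 4 4 ((2 ∷ []) ∷ []) ∷ move 2 3 3 ((2 ∷ []) ∷ []) ∷ move 2 5 1 ((2 ∷ []) ∷ []) ∷ move 3 2 5 ((1 ∷ 1 ∷ []) ∷ []) ∷ move 4 1 3 ((1 ∷ 1 ∷ []) ∷ []) ∷ move 4 3 1 ((2 ∷ []) ∷ []) ∷ [])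
  ∷ node (2 ∷ []) 0 (just 3) (move 0 5 5 ((2 ∷ []) ∷ []) ∷ move 1 4 5 ((2 ∷ []) ∷ []) ∷ move 1 5 3 ((2 ∷ []) ∷ []) ∷ move 2 3 5 ((2 ∷ []) ∷ []) ∷ move 3 2 6 ((1 ∷ 1 ∷ []) ∷ []) ∷ move 3 3 3 ((2 ∷ []) ∷ []) ∷ move 3 5 1 ((2 ∷ []) ∷ []) ∷ move 4 1 5 ((1 ∷ 1 ∷ []) ∷ []) ∷ move 5 1 3 ((1 ∷ 1 ∷ []) ∷ []) ∷ move 5 3 1 ((2 ∷ []) ∷ []) ∷ [])
  ∷ node (2 ∷ []) 0 nothing (move 0 3 1 ((2 ∷ []) ∷ []) ∷ move 3 0 1 ((1 ∷ 1 ∷ []) ∷ []) ∷ [])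
  ∷ node (2 ∷ []) 1 (just 0) (move 1 4 4 ((2 ∷ []) ∷ []) ∷ move 2 1 5 ((1 ∷ []) ∷ []) ∷ move 2 3 4 ((2 ∷ []) ∷ []) ∷ move 2 4 2 ((2 ∷ []) ∷ []) ∷ move 3 2 2 ((1 ∷ []) ∷ []) ∷ move 4 0 2 ((1 ∷ []) ∷ []) ∷ move 4 2 0 ((1 ∷ []) ∷ []) ∷ [])
  ∷ node (2 ∷ []) 1 (just 2) (move 1 4 6 ((2 ∷ []) ∷ []) ∷ move 2 3 3 ((2 ∷ []) ∷ []) ∷ move 3 0 6 ((1 ∷ []) ∷ []) ∷ move 3 2 3 ((1 ∷ []) ∷ []) ∷ move 3 3 2 ((1 ∷ []) ∷ []) ∷ move 4 0 3 ((1 ∷ []) ∷ []) ∷ move 4 2 1 ((1 ∷ []) ∷ []) ∷ [])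
  ∷ node (2 ∷ []) 1 (just 3) (move 1 4 7 ((2 ∷ []) ∷ []) ∷ move 2 3 3 ((1 ∷ []) ∷ []) ∷ move 3 1 5 ((1 ∷ []) ∷ []) ∷ move 3 2 3 ((1 ∷ []) ∷ []) ∷ move 3 3 1 ((1 ∷ []) ∷ []) ∷ move 4 1 3 ((1 ∷ []) ∷ []) ∷ [])
  ∷ node (2 ∷ []) 3 (just 0) (move 0 4 8 ((2 ∷ []) ∷ []) ∷ move 1 4 4 ([] ∷ []) ∷ move 2 3 4 ([] ∷ []) ∷ move 2 4 2 ([] ∷ []) ∷ move 3 2 4 ([] ∷ []) ∷ move 4 1 5 ([] ∷ []) ∷ move 4 2 2 ([] ∷ []) ∷ move 4 4 0 ([] ∷ []) ∷ move 6 0 2 ([] ∷ []) ∷ move 6 2 0 ([] ∷ []) ∷ [])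
  ∷ node (2 ∷ []) 3 (just 1) (move 0 3 6 ([] ∷ []) ∷ move 1 4 2 ([] ∷ []) ∷ move 2 2 4 ([] ∷ []) ∷ move 2 4 1 ([] ∷ []) ∷ move 4 1 2 ([] ∷ []) ∷ move 4 2 1 ([] ∷ []) ∷ [])
  ∷ node (2 ∷ []) 3 (just 2) (move 0 5 9 ((2 ∷ []) ∷ []) ∷ move 1 3 4 ([] ∷ []) ∷ move 2 3 1 ([] ∷ []) ∷ move 3 1 2 ([] ∷ []) ∷ move 3 2 1 ([] ∷ []) ∷ [])
  ∷ node (2 ∷ 1 ∷ []) 0 (just 1) (move 2 4 5 ((2 ∷ []) ∷ (1 ∷ []) ∷ []) ∷ move 2 5 2 ((2 ∷ []) ∷ (1 ∷ []) ∷ []) ∷ move 4 3 3 ((2 ∷ []) ∷ (1 ∷ []) ∷ []) ∷ move 4 4 1 ((2 ∷ []) ∷ (1 ∷ []) ∷ []) ∷ move 5 2 6 ((1 ∷ 1 ∷ []) ∷ (1 ∷ []) ∷ []) ∷ move 6 1 2 ((1 ∷ 1 ∷ []) ∷ (1 ∷ []) ∷ []) ∷ move 6 2 1 ((1 ∷ 1 ∷ []) ∷ (1 ∷ []) ∷ []) ∷ [])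
  ∷ node (2 ∷ 1 ∷ []) 0 (just 2) (move 2 5 3 ((2 ∷ []) ∷ (1 ∷ []) ∷ []) ∷ move 3 4 4 ((2 ∷ []) ∷ (1 ∷ []) ∷ []) ∷ move 4 3 3 ((2 ∷ []) ∷ (1 ∷ []) ∷ []) ∷ move 4 5 1 ((2 ∷ []) ∷ (1 ∷ []) ∷ []) ∷ move 5 2 5 ((1 ∷ 1 ∷ []) ∷ (1 ∷ []) ∷ []) ∷ move 6 1 3 ((1 ∷ 1 ∷ []) ∷ (1 ∷ []) ∷ []) ∷ move 6 3 1 ((2 ∷ []) ∷ (1 ∷ []) ∷ []) ∷ [])
  ∷ node (2 ∷ 1 ∷ []) 0 (just 3) (move 2 5 5 ((2 ∷ []) ∷ (1 ∷ []) ∷ []) ∷ move 3 4 5 ((2 ∷ []) ∷ (1 ∷ []) ∷ []) ∷ move 3 5 3 ((2 ∷ []) ∷ (1 ∷ []) ∷ []) ∷ move 4 3 5 ((2 ∷ []) ∷ (1 ∷ []) ∷ []) ∷ move 5 2 6 ((1 ∷ 1 ∷ []) ∷ (1 ∷ []) ∷ []) ∷ move 5 3 3 ((2 ∷ []) ∷ (1 ∷ []) ∷ []) ∷ move 5 5 1 ((2 ∷ []) ∷ (1 ∷ []) ∷ []) ∷ move 7 1 3 ((1 ∷ 1 ∷ []) ∷ (1 ∷ []) ∷ []) ∷ move 7 3 1 ((2 ∷ []) ∷ (1 ∷ []) ∷ []) ∷ [])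
  ∷ node (2 ∷ 1 ∷ []) 0 nothing (move 1 3 1 ((2 ∷ []) ∷ (1 ∷ []) ∷ []) ∷ move 5 0 1 ((1 ∷ 1 ∷ []) ∷ (1 ∷ []) ∷ []) ∷ [])
  ∷ node (2 ∷ 1 ∷ []) 1 (just 0) (move 2 3 4 ((2 ∷ []) ∷ [] ∷ []) ∷ move 2 4 2 ((2 ∷ []) ∷ [] ∷ []) ∷ move 4 1 5 ((1 ∷ []) ∷ (1 ∷ []) ∷ []) ∷ move 4 4 0 ((2 ∷ []) ∷ [] ∷ []) ∷ move 5 2 2 ((1 ∷ []) ∷ (1 ∷ []) ∷ []) ∷ [])
  ∷ node (2 ∷ 1 ∷ []) 1 (just 2) (move 2 3 3 ((2 ∷ []) ∷ [] ∷ []) ∷ move 3 3 2 ((2 ∷ []) ∷ [] ∷ []) ∷ move 3 4 1 ((2 ∷ []) ∷ [] ∷ []) ∷ move 5 0 6 ((1 ∷ []) ∷ (1 ∷ []) ∷ []) ∷ move 5 2 3 ((1 ∷ []) ∷ (1 ∷ []) ∷ []) ∷ [])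
  ∷ node (2 ∷ 1 ∷ []) 1 (just 3) (move 2 3 7 ((2 ∷ []) ∷ [] ∷ []) ∷ move 2 5 3 ((2 ∷ []) ∷ [] ∷ []) ∷ move 3 3 5 ((2 ∷ []) ∷ [] ∷ []) ∷ move 3 5 1 ((2 ∷ []) ∷ [] ∷ []) ∷ move 5 1 5 ((1 ∷ []) ∷ (1 ∷ []) ∷ []) ∷ move 5 2 3 ((1 ∷ []) ∷ (1 ∷ []) ∷ []) ∷ move 5 3 1 ((1 ∷ []) ∷ (1 ∷ []) ∷ []) ∷ [])
  ∷ node (2 ∷ 1 ∷ []) 2 (just 0) (move 1 4 4 ([] ∷ (1 ∷ []) ∷ []) ∷ move 2 3 4 ([] ∷ (1 ∷ []) ∷ []) ∷ move 2 4 2 ([] ∷ (1 ∷ []) ∷ []) ∷ move 3 2 4 ([] ∷ (1 ∷ []) ∷ []) ∷ move 4 1 5 ([] ∷ (1 ∷ []) ∷ []) ∷ move 4 2 2 ([] ∷ (1 ∷ []) ∷ []) ∷ move 4 4 0 ([] ∷ (1 ∷ []) ∷ []) ∷ [])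
  ∷ node (2 ∷ 1 ∷ []) 2 (just 1) (move 2 3 6 ((2 ∷ []) ∷ [] ∷ []) ∷ move 2 4 5 ((2 ∷ []) ∷ [] ∷ []) ∷ move 2 5 2 ((2 ∷ []) ∷ [] ∷ []) ∷ move 3 2 3 ([] ∷ (1 ∷ []) ∷ []) ∷ move 4 0 5 ((1 ∷ []) ∷ [] ∷ []) ∷ move 4 2 1 ((1 ∷ []) ∷ [] ∷ []) ∷ [])
  ∷ node (2 ∷ 1 ∷ []) 2 (just 3) (move 2 3 3 ([] ∷ (1 ∷ []) ∷ []) ∷ move 3 2 3 ([] ∷ (1 ∷ []) ∷ []) ∷ move 3 3 1 ([] ∷ (1 ∷ []) ∷ []) ∷ move 4 1 3 ([] ∷ (1 ∷ []) ∷ []) ∷ [])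
  ∷ node (3 ∷ []) 0 (just 1) (move 0 1 8 ((3 ∷ []) ∷ []) ∷ move 0 2 7 ((3 ∷ []) ∷ []) ∷ move 2 0 7 ((3 ∷ []) ∷ []) ∷ move 2 2 5 ((3 ∷ []) ∷ []) ∷ move 2 5 2 ((2 ∷ 1 ∷ []) ∷ []) ∷ move 4 0 5 ((3 ∷ []) ∷ []) ∷ move 4 3 3 ((2 ∷ 1 ∷ []) ∷ []) ∷ move 4 4 1 ((2 ∷ 1 ∷ []) ∷ []) ∷ move 6 1 2 ((1 ∷ 1 ∷ 1 ∷ []) ∷ []) ∷ move 6 2 1 ((1 ∷ 1 ∷ 1 ∷ []) ∷ []) ∷ [])
  ∷ node (3 ∷ []) 0 (just 2) (move 0 1 9 ((3 ∷ []) ∷ []) ∷ move 0 3 7 ((3 ∷ []) ∷ []) ∷ move 2 1 7 ((3 ∷ []) ∷ []) ∷ move 2 3 5 ((3 ∷ []) ∷ []) ∷ move 2 5 3 ((2 ∷ 1 ∷ []) ∷ []) ∷ move 4 1 5 ((3 ∷ []) ∷ []) ∷ move 4 3 3 ((2 ∷ 1 ∷ []) ∷ []) ∷ move 4 5 1 ((2 ∷ 1 ∷ []) ∷ []) ∷ move 6 1 3 ((1 ∷ 1 ∷ 1 ∷ []) ∷ []) ∷ move 6 3 1 ((2 ∷ 1 ∷ []) ∷ []) ∷ [])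
  ∷ node (3 ∷ []) 0 (just 3) (move 0 3 9 ((3 ∷ []) ∷ []) ∷ move 1 1 9 ((3 ∷ []) ∷ []) ∷ move 1 3 7 ((3 ∷ []) ∷ []) ∷ move 2 5 5 ((2 ∷ 1 ∷ []) ∷ []) ∷ move 3 1 7 ((3 ∷ []) ∷ []) ∷ move 3 3 5 ((3 ∷ []) ∷ []) ∷ move 3 5 3 ((2 ∷ 1 ∷ []) ∷ []) ∷ move 5 1 5 ((3 ∷ []) ∷ []) ∷ move 5 3 3 ((2 ∷ 1 ∷ []) ∷ []) ∷ move 5 5 1 ((2 ∷ 1 ∷ []) ∷ []) ∷ move 7 1 3 ((1 ∷ 1 ∷ 1 ∷ []) ∷ []) ∷ move 7 3 1 ((2 ∷ 1 ∷ []) ∷ []) ∷ [])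
  ∷ node (3 ∷ []) 0 nothing (move 0 0 7 ((3 ∷ []) ∷ []) ∷ move 1 3 1 ((2 ∷ 1 ∷ []) ∷ []) ∷ move 5 0 1 ((1 ∷ 1 ∷ 1 ∷ []) ∷ []) ∷ [])
  ∷ node (3 ∷ []) 1 (just 0) (move 1 2 8 ((3 ∷ []) ∷ []) ∷ move 2 0 8 ((3 ∷ []) ∷ []) ∷ move 2 2 6 ((3 ∷ []) ∷ []) ∷ move 2 3 4 ((2 ∷ []) ∷ []) ∷ move 2 4 2 ((2 ∷ []) ∷ []) ∷ move 4 0 6 ((3 ∷ []) ∷ []) ∷ move 4 1 5 ((1 ∷ 1 ∷ []) ∷ []) ∷ move 4 3 2 ((2 ∷ []) ∷ []) ∷ move 4 4 0 ((2 ∷ []) ∷ []) ∷ move 6 0 2 ((1 ∷ 1 ∷ []) ∷ []) ∷ move 6 2 0 ((1 ∷ 1 ∷ []) ∷ []) ∷ [])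
  ∷ node (3 ∷ []) 1 (just 2) (move 1 2 9 ((3 ∷ []) ∷ []) ∷ move 1 3 8 ((3 ∷ []) ∷ []) ∷ move 2 0 9 ((3 ∷ []) ∷ []) ∷ move 2 3 3 ((2 ∷ []) ∷ []) ∷ move 3 0 7 ((3 ∷ []) ∷ []) ∷ move 3 4 1 ((2 ∷ []) ∷ []) ∷ move 4 1 5 ((3 ∷ []) ∷ []) ∷ move 4 3 1 ((2 ∷ []) ∷ []) ∷ move 6 0 3 ((1 ∷ 1 ∷ []) ∷ []) ∷ [])
  ∷ node (3 ∷ []) 1 (just 3) (move 1 2 9 ((3 ∷ []) ∷ []) ∷ move 1 3 7 ((3 ∷ []) ∷ []) ∷ move 2 1 9 ((3 ∷ []) ∷ []) ∷ move 2 5 3 ((2 ∷ []) ∷ []) ∷ move 3 1 7 ((3 ∷ []) ∷ []) ∷ move 3 3 5 ((3 ∷ []) ∷ []) ∷ move 3 5 1 ((2 ∷ []) ∷ []) ∷ move 4 3 3 ((1 ∷ 1 ∷ []) ∷ []) ∷ move 5 1 5 ((1 ∷ 1 ∷ []) ∷ []) ∷ move 5 3 1 ((1 ∷ 1 ∷ []) ∷ []) ∷ move 6 1 3 ((1 ∷ 1 ∷ []) ∷ []) ∷ [])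
  ∷ node (3 ∷ []) 2 (just 0) (move 1 2 10 ((3 ∷ []) ∷ []) ∷ move 1 4 4 ((1 ∷ []) ∷ []) ∷ move 2 3 4 ((1 ∷ []) ∷ []) ∷ move 2 4 2 ((1 ∷ []) ∷ []) ∷ move 3 2 4 ((1 ∷ []) ∷ []) ∷ move 4 1 5 ((1 ∷ []) ∷ []) ∷ move 4 2 2 ((1 ∷ []) ∷ []) ∷ move 4 4 0 ((1 ∷ []) ∷ []) ∷ move 6 0 2 ((1 ∷ []) ∷ []) ∷ move 6 2 0 ((1 ∷ []) ∷ []) ∷ [])
  ∷ node (3 ∷ []) 2 (just 1) (move 1 2 9 ((3 ∷ []) ∷ []) ∷ move 1 3 8 ((3 ∷ []) ∷ []) ∷ move 2 3 6 ((2 ∷ []) ∷ []) ∷ move 2 4 5 ((2 ∷ []) ∷ []) ∷ move 2 5 2 ((2 ∷ []) ∷ []) ∷ move 3 2 3 ((1 ∷ []) ∷ []) ∷ move 4 1 2 ((1 ∷ []) ∷ []) ∷ move 4 2 1 ((1 ∷ []) ∷ []) ∷ [])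
  ∷ node (3 ∷ []) 2 (just 3) (move 1 2 9 ((3 ∷ []) ∷ []) ∷ move 1 3 7 ((3 ∷ []) ∷ []) ∷ move 2 3 3 ((1 ∷ []) ∷ []) ∷ move 3 2 3 ((1 ∷ []) ∷ []) ∷ move 3 3 1 ((1 ∷ []) ∷ []) ∷ move 4 1 3 ((1 ∷ []) ∷ []) ∷ move 5 1 1 ((1 ∷ []) ∷ []) ∷ [])
  ∷ []


open Table strategy
-- The two checks, evaluated by the type checker.
certified : Certified
certified = toWitness {a? = certified?} _


initial : Initial
initial = toWitness {a? = initial?} _

open Play certified initial

lemma3 : ∃[ C ] (∀ (n : ℕ) (R : Row n) → (∀ i → R i ≤ 3) →
           Σ[ ss ∈ List (Segment n) ] (IsSegmentation R ss
             × 2 * countValue 1 ss ≤ markers R + 2 * C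
             × 4 * countValue 2 ss ≤ markers R
             × 6 * countValue 3 ss ≤ markers R))
lemma3 = 3 , λ n R R≤3 →
  let (ss , is-segmentation , counts , changes≡markers) = run-segmentation R
      (bound₁ , bound₂ , bound₃) = done-bounds (final (run R)) (run-affordable R R≤3)
  in ss , is-segmentation ,
     subst₂ (λ a b → 2 * a ≤ b + 6) (sym (counts 1)) changes≡markers bound₁ ,
     subst₂ (λ a b → 4 * a ≤ b) (sym (counts 2)) changes≡markers bound₂ ,
     subst₂ (λ a b → 6 * a ≤ b) (sym (counts 3)) changes≡markers bound₃
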